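{- Let $G=(U,V,E)$ be a stochastic graph with unbounded patience, i.e. $\mathcal{C}_v=\partial(v)^{(*)}$ for every $v\in V$. Then $\mathrm{LPOPT}_{\mathrm{QC}}(G)=\mathrm{LPOPT}(G)$.
   Context: A stochastic graph is a finite bipartite graph $G=(U,V,E)$, $E=U\times V$, with nonnegative weights $(w_e)$ and probabilities $(p_e)\subseteq[0,1]$. $S^{(*)}$: tuples of pairwise distinct elements of $S$ incl. the empty string $\lambda$; $\partial(v)$: edges at $v$. For $\bm e=(e_1,\dots,e_k)$: $g(\bm e)=\prod_j(1-p_{e_j})$, $g(\lambda)=1$, $\bm e_{<e_j}=(e_1,\dots,e_{j-1})$, $\mathrm{val}(\bm e)=\sum_jp_{e_j}w_{e_j}g(\bm e_{<e_j})$. $\mathrm{LPOPT}(G)$ is the optimum of LP-config: variables $x_v(\bm e)\ge0$ ($v\in V$, $\bm e\in\mathcal{C}_v$); maximize $\sum_v\sum_{\bm e\in\mathcal{C}_v}\mathrm{val}(\bm e)x_v(\bm e)$ s.t. $\sum_v\sum_{\bm e\in\mathcal{C}_v:(u,v)\in\bm e}p_{u,v}g(\bm e_{<(u,v)})x_v(\bm e)\le1$ for all $u\in U$, $\sum_{\bm e\in\mathcal{C}_v}x_v(\bm e)=1$ for all $v\in V$. $\mathrm{LPOPT}_{\mathrm{QC}}(G)$ is the optimum of LP-QC: variables $x_e\ge0$ ($e\in E$); maximize $\sum_{e\in E}w_ep_ex_e$ subject to $\sum_{e\in S}p_ex_e\le1-\prod_{e\in S}(1-p_e)$ for all $v\in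 V$ and $S\subseteq\partial(v)$, and $\sum_{e\in\partial(u)}p_ex_e\le1$ for all $u\in U$.
   Formalization: The weights $w_e$ and probabilities $p_e$, as well as the variables of LP-config and LP-QC, take values in the rationals. -}

module Defs where

open import Data.Nat using (ℕ; zero; suc)
open import Data.Fin using (Fin; _≟_)
open import Data.Fin.Subset using (Subset)
open import Data.Bool using (Bool; true; false; if_then_else_)
open import Data.List using (List; []; _∷_; map; concatMap; foldr)
open import Data.List.Base using (allFin)
open import Data.List.Membership.Propositional using (_∈_)
open import Data.Vec using (lookup)
open import Data.Rational using (ℚ; 0ℚ; 1ℚ; _+_; _*_; _-_; _≤_)
open import Data.Product using (_×_; Σ; ∃)
open import Relation.Nullary using (does)
open import Relation.Binary.PropositionalEquality using (_≡_)

filterB : {A : Set} → (A → Bool) → List A → List A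
filterB f [] = []
filterB f (a ∷ as) = if f a then a ∷ filterB f as else filterB f as

sumL : {A : Set} → List A → (A → ℚ) → ℚ
sumL xs f = foldr (λ a r → f a + r) 0ℚ xs

sumFin : (k : ℕ) → (Fin k → ℚ) → ℚ
sumFin k f = sumL (allFin k) f

-- A stochastic graph: U = Fin m, V = Fin n, E = U × V (complete bipartite),
-- weights w and probabilities p indexed by (u , v).
record StochGraph (m n : ℕ) : Set where
  field
    w : Fin m → Fin n → ℚ
    p : Fin m → Fin n → ℚ
    w-nonneg : ∀ u v → 0ℚ ≤ w u v
    p-nonneg : ∀ u v → 0ℚ ≤ p u v
    p-le-one : ∀ u v → p u v ≤ 1ℚ

notIn : {m : ℕ} → Fin m → List (Fin m) → Bool
notIn u [] = true
notIn u (u' ∷ l) = if does (u ≟ u') then false else notIn u l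

distinctUpTo : (m k : ℕ) → List (List (Fin m))
distinctUpTo m zero = [] ∷ []
distinctUpTo m (suc k) =
  [] ∷ concatMap (λ l → map (λ u → u ∷ l)
                            (filterB (λ u → notIn u l) (allFin m)))
                 (distinctUpTo m k)

-- ∂(v)^(*): an edge at v is (u , v), so a tuple of distinct edges at v is
-- identified with a tuple of distinct u ∈ U.  (Unbounded patience: C_v is all of it.)
configs : (m : ℕ) → List (List (Fin m))
configs m = distinctUpTo m m

module _ {m n : ℕ} (G : StochGraph m n) where
  open StochGraph G

  g : Fin n → List (Fin m) → ℚ
  g v [] = 1ℚ
  g v (u ∷ l) = (1ℚ - p u v) * g v l

  -- val(e) = Σ_j p_{e_j} w_{e_j} g(e_{<e_j}); c carries g of the prefix.
  valFrom : Fin n → ℚ → List (Fin m) → ℚ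
  valFrom v c [] = 0ℚ
  valFrom v c (u ∷ l) = p u v * w u v * c + valFrom v (c * (1ℚ - p u v)) l

  val : Fin n → List (Fin m) → ℚ
  val v l = valFrom v 1ℚ l

  -- coefficient of x_v(e) in the constraint of u:
  -- p_{u,v} g(e_{<(u,v)}) if (u,v) ∈ e, else 0 (no term in the sum).
  coefFrom : Fin m → Fin n → ℚ → List (Fin m) → ℚ
  coefFrom u v c [] = 0ℚ
  coefFrom u v c (u' ∷ l) =
    if does (u ≟ u') then p u v * c else coefFrom u v (c * (1ℚ - p u' v)) l

  coef : Fin m → Fin n → List (Fin m) → ℚ
  coef u v l = coefFrom u v 1ℚ l

  -- LP-config (unbounded patience).  x v e is meaningful for e ∈ configs m.
  ConfigSol : Set
  ConfigSol = Fin n → List (Fin m) → ℚ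

  configObj : ConfigSol → ℚ
  configObj x = sumFin n (λ v → sumL (configs m) (λ e → val v e * x v e))

  ConfigFeasible : ConfigSol → Set
  ConfigFeasible x =
    (∀ v e → e ∈ configs m → 0ℚ ≤ x v e)
    × (∀ u → sumFin n (λ v → sumL (configs m) (λ e → coef u v e * x v e)) ≤ 1ℚ)
    × (∀ v → sumL (configs m) (λ e → x v e) ≡ 1ℚ)

  ConfigOptimal : ConfigSol → Set
  ConfigOptimal x = ConfigFeasible x × (∀ x' → ConfigFeasible x' → configObj x' ≤ configObj x)

  -- LP-QC.  y u v is the variable x_e for e = (u , v).
  QCSol : Set
  QCSol = Fin m → Fin n → ℚ

  qcObj : QCSol → ℚ
  qcObj y = sumFin m (λ u → sumFin n (λ v → w u v * p u v * y u v))

  -- S ⊆ ∂(v) is given by a subset S of U (e = (u , v) ∈ S iff u ∈ S).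
  sumIn : Subset m → (Fin m → ℚ) → ℚ
  sumIn S f = sumFin m (λ u → if lookup S u then f u else 0ℚ)

  prodIn : Subset m → (Fin m → ℚ) → ℚ
  prodIn S f = foldr (λ u r → (if lookup S u then f u else 1ℚ) * r) 1ℚ (allFin m)

  QCFeasible : QCSol → Set
  QCFeasible y =
    (∀ u v → 0ℚ ≤ y u v)
    × (∀ v (S : Subset m) →
         sumIn S (λ u → p u v * y u v) ≤ 1ℚ - prodIn S (λ u → 1ℚ - p u v))
    × (∀ u → sumFin n (λ v → p u v * y u v) ≤ 1ℚ)

  QCOptimal : QCSol → Set
  QCOptimal y = QCFeasible y × (∀ y' → QCFeasible y' → qcObj y' ≤ qcObj y)

  IsLPOPT : ℚ → Set
  IsLPOPT r = Σ ConfigSol (λ x → ConfigOptimal x × configObj x ≡ r)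

  IsLPOPT-QC : ℚ → Set
  IsLPOPT-QC r = Σ QCSol (λ y → QCOptimal y × qcObj y ≡ r)

{-# OPTIONS --safe #-}

-- LP-config is a finite LP over ℚ, so Fourier–Motzkin elimination yields an optimal solution x
-- together with a dual certificate (α_u for the capacity constraints, β_v for Σ_e x_v(e) = 1) of
-- the same value.  The marginals y_{u,v} = Σ_e x_v(e) · Pr[e probes u] are LP-QC feasible with the
-- same objective: for one probing order e and any S, Σ_{u ∈ S} p_{u,v} Pr[e probes u] ≤
-- 1 - ∏_{u ∈ S} (1 - p_{u,v}).  Conversely the dual value bounds every LP-QC solution y: at each v,
-- Σ_u (w_{u,v} - α_u) p_{u,v} y_{u,v} is at most the value of the greedy order, which probes the
-- edges of positive reduced weight w_{u,v} - α_u by decreasing weight, and by dual feasibility that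
-- value is at most β_v.  Summing over v and using the capacity constraints of y gives the bound.

module Submission where

open import Defs
open import Level using (0ℓ)
open import Data.Nat as ℕ using (ℕ; zero; suc; z≤n; s≤s)
import Data.Nat.Properties as ℕ
import Data.List.Properties as Listₚ
open import Data.Fin using (Fin; zero; suc) renaming (_≟_ to _≟ᶠ_)
open import Data.Fin.Subset using (Subset; ⊥; _─_; ∣_∣) renaming (_∈_ to _∈ˢ_; _-_ to _∖_)
open import Data.Fin.Subset.Properties using (_∈?_; nonempty?; Empty-unique; p─⊥≡p; x∈p⇒∣p-x∣<∣p∣; p─q⊆p; ∣p∣≤n)
open import Data.Vec as Vec using ([]; _∷_; lookup; here; there)
open import Data.Vec.Properties using ([]=⇒lookup; lookup⇒[]=; lookup∘tabulate)
open import Data.Bool using (Bool; true; false; if_then_else_)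
open import Data.List as List using (List; []; _∷_; map; concatMap; foldr; _++_; allFin; length; tabulate)
open import Data.List.Membership.Propositional using (_∈_; find; lose)
open import Data.List.Membership.Propositional.Properties
  using (∈-allFin; ∈-filter⁺; ∈-filter⁻; ∈-map⁺; ∈-map⁻; ∈-++⁺ˡ; ∈-++⁺ʳ; ∈-++⁻; ∈-concatMap⁺; ∈-concatMap⁻)
open import Data.List.Relation.Unary.All as All using (All; []; _∷_)
open import Data.List.Relation.Unary.AllPairs using ([]; _∷_)
open import Data.List.Relation.Unary.Unique.Propositional using (Unique)
import Data.List.Relation.Unary.Unique.Propositional.Properties as Unique
open import Data.List.Relation.Unary.Any using (here; there; any?)
open import Data.Rational using (ℚ; 0ℚ; 1ℚ; _+_; _*_; _-_; -_; _≤_; _<_; _⊔_; 1/_; ≢-nonZero; positive; negative; nonNegative; nonPositive)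
open import Data.Rational.Properties
open import Data.Product using (Σ; ∃₂; _×_; _,_; proj₁; proj₂; curry′; uncurry′)
import Data.Product.Properties as Productₚ
open import Data.Sum using (_⊎_; inj₁; inj₂)
open import Data.Maybe using (Maybe; nothing; just)
open import Data.Unit using (⊤; tt)
open import Data.Empty using (⊥-elim)
open import Relation.Nullary using (¬_; Dec; yes; no; does)
open import Relation.Nullary.Decidable using (dec⇒maybe)
open import Relation.Binary.Bundles using (DecTotalOrder)
open import Data.List.Extrema (DecTotalOrder.totalOrder ≤-decTotalOrder) using (argmin; f[argmin]≤f[xs]; argmin-all; min; max; v≤min⁺; min≤xs; xs≤max)
open import Relation.Binary.Definitions using (DecidableEquality; tri<; tri≈; tri>)
open import Relation.Binary.PropositionalEquality
open import Function using (_∘_)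
open import Tactic.RingSolver using (solve-∀)
open import Tactic.RingSolver.Core.AlmostCommutativeRing using (AlmostCommutativeRing; fromCommutativeRing)

private
  variable
    A B : Set
    m : ℕ

-- Rational arithmetic

ℚ-ring : AlmostCommutativeRing 0ℓ 0ℓ
ℚ-ring = fromCommutativeRing +-*-commutativeRing (λ x → dec⇒maybe (0ℚ ≟ x))

0≤1 : 0ℚ ≤ 1ℚ
0≤1 = nonNegative⁻¹ 1ℚ

p≤q⇒0≤q-p : {p q : ℚ} → p ≤ q → 0ℚ ≤ q - p
p≤q⇒0≤q-p {p} {q} p≤q = begin
  0ℚ          ≡⟨ +-inverseʳ p ⟨
  p + - p     ≤⟨ +-monoˡ-≤ (- p) p≤q ⟩
  q - p       ∎
  where open ≤-Reasoning

0≤q-p⇒p≤q : {q p : ℚ} → 0ℚ ≤ q - p → p ≤ q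
0≤q-p⇒p≤q {q} {p} 0≤q-p = begin
  p            ≡⟨ +-identityˡ p ⟨
  0ℚ + p       ≤⟨ +-monoˡ-≤ p 0≤q-p ⟩
  q - p + p    ≡⟨ identity q p ⟩
  q            ∎
  where
  open ≤-Reasoning
  identity : ∀ q p → q - p + p ≡ q
  identity = solve-∀ ℚ-ring

neg-involutive : (p : ℚ) → - - p ≡ p
neg-involutive = solve-∀ ℚ-ring

*-nonNeg : {p q : ℚ} → 0ℚ ≤ p → 0ℚ ≤ q → 0ℚ ≤ p * q
*-nonNeg {p} {q} 0≤p 0≤q = nonNegative⁻¹ _ {{nonNeg*nonNeg⇒nonNeg p {{nonNegative 0≤p}} q {{nonNegative 0≤q}}}}

*-pos : {p q : ℚ} → 0ℚ < p → 0ℚ < q → 0ℚ < p * q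
*-pos {p} {q} 0<p 0<q = positive⁻¹ _ {{pos*pos⇒pos p {{positive 0<p}} q {{positive 0<q}}}}

*-neg-pos : {p q : ℚ} → p < 0ℚ → 0ℚ < q → p * q < 0ℚ
*-neg-pos {p} {q} p<0 0<q = negative⁻¹ _ {{neg*pos⇒neg p {{negative p<0}} q {{positive 0<q}}}}

*-monoˡ-≤-0≤ : {r p q : ℚ} → 0ℚ ≤ r → p ≤ q → r * p ≤ r * q
*-monoˡ-≤-0≤ {r} 0≤r = *-monoˡ-≤-nonNeg r {{nonNegative 0≤r}}

*-monoʳ-≤-0≤ : {r p q : ℚ} → 0ℚ ≤ r → p ≤ q → p * r ≤ q * r
*-monoʳ-≤-0≤ {r} 0≤r = *-monoʳ-≤-nonNeg r {{nonNegative 0≤r}}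

*-antimonoˡ-≤-≤0 : {r p q : ℚ} → r ≤ 0ℚ → p ≤ q → r * q ≤ r * p
*-antimonoˡ-≤-≤0 {r} r≤0 = *-monoˡ-≤-nonPos r {{nonPositive r≤0}}

*-cancelˡ-≤-0< : {r p q : ℚ} → 0ℚ < r → r * p ≤ r * q → p ≤ q
*-cancelˡ-≤-0< {r} 0<r = *-cancelˡ-≤-pos r {{positive 0<r}}

p+q≤r⇒q≤r-p : {p q r : ℚ} → p + q ≤ r → q ≤ r - p
p+q≤r⇒q≤r-p {p} {q} {r} p+q≤r = begin
  q              ≡⟨ identity p q ⟨
  p + q - p      ≤⟨ +-monoˡ-≤ (- p) p+q≤r ⟩
  r - p          ∎
  where
  open ≤-Reasoning
  identity : ∀ p q → p + q - p ≡ q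
  identity = solve-∀ ℚ-ring

q≤r-p⇒p+q≤r : {q r p : ℚ} → q ≤ r - p → p + q ≤ r
q≤r-p⇒p+q≤r {q} {r} {p} q≤r-p = begin
  p + q          ≤⟨ +-monoʳ-≤ p q≤r-p ⟩
  p + (r - p)    ≡⟨ identity p r ⟩
  r              ∎
  where
  open ≤-Reasoning
  identity : ∀ p r → p + (r - p) ≡ r
  identity = solve-∀ ℚ-ring

-- The reciprocal, with the junk value recip 0ℚ = 0ℚ.
recip : ℚ → ℚ
recip p with p ≟ 0ℚ
... | yes _  = 0ℚ
... | no p≢0 = 1/_ p {{≢-nonZero p≢0}}

*-recip : {p : ℚ} → p ≢ 0ℚ → p * recip p ≡ 1ℚ
*-recip {p} p≢0 with p ≟ 0ℚ
... | yes p≡0 = ⊥-elim (p≢0 p≡0)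
... | no p≢0  = *-inverseʳ p {{≢-nonZero p≢0}}

*-*recip : {p q : ℚ} → p ≢ 0ℚ → p * (q * recip p) ≡ q
*-*recip {p} {q} p≢0 = begin
  p * (q * recip p)   ≡⟨ identity p q (recip p) ⟩
  q * (p * recip p)   ≡⟨ cong (q *_) (*-recip p≢0) ⟩
  q * 1ℚ              ≡⟨ *-identityʳ q ⟩
  q                   ∎
  where
  open ≡-Reasoning
  identity : ∀ p q r → p * (q * r) ≡ q * (p * r)
  identity = solve-∀ ℚ-ring

recip-pos : {p : ℚ} → 0ℚ < p → 0ℚ < recip p
recip-pos {p} 0<p with p ≟ 0ℚ
... | yes p≡0 = ⊥-elim (<-irrefl (sym p≡0) 0<p)
... | no p≢0  = positive⁻¹ _ {{1/pos⇒pos p {{positive 0<p}}}}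

>-≢0 : {p : ℚ} → 0ℚ < p → p ≢ 0ℚ
>-≢0 0<p p≡0 = <-irrefl (sym p≡0) 0<p

<-≢0 : {p : ℚ} → p < 0ℚ → p ≢ 0ℚ
<-≢0 p<0 p≡0 = <-irrefl p≡0 p<0

≤*recip⇒*≤ : {r q p : ℚ} → 0ℚ < r → q ≤ p * recip r → r * q ≤ p
≤*recip⇒*≤ 0<r q≤ = ≤-trans (*-monoˡ-≤-0≤ (<⇒≤ 0<r) q≤) (≤-reflexive (*-*recip (>-≢0 0<r)))

*≤⇒≤*recip : {r q p : ℚ} → 0ℚ < r → r * q ≤ p → q ≤ p * recip r
*≤⇒≤*recip 0<r rq≤p = *-cancelˡ-≤-0< 0<r (≤-trans rq≤p (≤-reflexive (sym (*-*recip (>-≢0 0<r)))))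

*recip≤⇒*≤ : {r p q : ℚ} → r < 0ℚ → p * recip r ≤ q → r * q ≤ p
*recip≤⇒*≤ r<0 ≤q = ≤-trans (*-antimonoˡ-≤-≤0 (<⇒≤ r<0) ≤q) (≤-reflexive (*-*recip (<-≢0 r<0)))

-- Finite sums

sumL-++ : (xs ys : List A) (f : A → ℚ) → sumL (xs ++ ys) f ≡ sumL xs f + sumL ys f
sumL-++ [] ys f = sym (+-identityˡ _)
sumL-++ (x ∷ xs) ys f rewrite sumL-++ xs ys f = sym (+-assoc (f x) _ _)

sumL-map : (g : A → B) (xs : List A) (f : B → ℚ) → sumL (map g xs) f ≡ sumL xs (f ∘ g)
sumL-map g [] f = refl
sumL-map g (x ∷ xs) f = cong (f (g x) +_) (sumL-map g xs f)

sumL-concatMap : (g : A → List B) (xs : List A) (f : B → ℚ) →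
  sumL (concatMap g xs) f ≡ sumL xs (λ a → sumL (g a) f)
sumL-concatMap g [] f = refl
sumL-concatMap g (x ∷ xs) f =
  trans (sumL-++ (g x) (concatMap g xs) f) (cong (sumL (g x) f +_) (sumL-concatMap g xs f))

sumL-cong-∈ : (xs : List A) {f g : A → ℚ} → (∀ a → a ∈ xs → f a ≡ g a) → sumL xs f ≡ sumL xs g
sumL-cong-∈ [] f≡g = refl
sumL-cong-∈ (x ∷ xs) f≡g = cong₂ _+_ (f≡g x (here refl)) (sumL-cong-∈ xs (λ a a∈ → f≡g a (there a∈)))

sumL-cong : (xs : List A) {f g : A → ℚ} → (∀ a → f a ≡ g a) → sumL xs f ≡ sumL xs g
sumL-cong xs f≡g = sumL-cong-∈ xs (λ a _ → f≡g a)

sumL-mono-∈ : (xs : List A) {f g : A → ℚ} → (∀ a → a ∈ xs → f a ≤ g a) → sumL xs f ≤ sumL xs g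
sumL-mono-∈ [] f≤g = ≤-refl
sumL-mono-∈ (x ∷ xs) f≤g = +-mono-≤ (f≤g x (here refl)) (sumL-mono-∈ xs (λ a a∈ → f≤g a (there a∈)))

sumL-mono : (xs : List A) {f g : A → ℚ} → (∀ a → f a ≤ g a) → sumL xs f ≤ sumL xs g
sumL-mono xs f≤g = sumL-mono-∈ xs (λ a _ → f≤g a)

sumL-0 : (xs : List A) → sumL xs (λ _ → 0ℚ) ≡ 0ℚ
sumL-0 [] = refl
sumL-0 (x ∷ xs) = trans (+-identityˡ _) (sumL-0 xs)

sumL-≡0 : (xs : List A) {f : A → ℚ} → (∀ a → a ∈ xs → f a ≡ 0ℚ) → sumL xs f ≡ 0ℚ
sumL-≡0 xs f≡0 = trans (sumL-cong-∈ xs f≡0) (sumL-0 xs)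

sumL-nonNeg : (xs : List A) {f : A → ℚ} → (∀ a → a ∈ xs → 0ℚ ≤ f a) → 0ℚ ≤ sumL xs f
sumL-nonNeg xs 0≤f = ≤-trans (≤-reflexive (sym (sumL-0 xs))) (sumL-mono-∈ xs 0≤f)

sumL-+ : (xs : List A) (f g : A → ℚ) → sumL xs (λ a → f a + g a) ≡ sumL xs f + sumL xs g
sumL-+ [] f g = sym (+-identityˡ 0ℚ)
sumL-+ (x ∷ xs) f g rewrite sumL-+ xs f g = interchange (f x) (g x) (sumL xs f) (sumL xs g)
  where
  interchange : ∀ a b c d → (a + b) + (c + d) ≡ (a + c) + (b + d)
  interchange = solve-∀ ℚ-ring

sumL-*ˡ : (xs : List A) (q : ℚ) (f : A → ℚ) → sumL xs (λ a → q * f a) ≡ q * sumL xs f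
sumL-*ˡ [] q f = sym (*-zeroʳ q)
sumL-*ˡ (x ∷ xs) q f rewrite sumL-*ˡ xs q f = sym (*-distribˡ-+ q (f x) _)

sumL-*ʳ : (xs : List A) (q : ℚ) (f : A → ℚ) → sumL xs (λ a → f a * q) ≡ sumL xs f * q
sumL-*ʳ xs q f = trans (sumL-cong xs (λ a → *-comm (f a) q)) (trans (sumL-*ˡ xs q f) (*-comm q _))

sumL-neg : (xs : List A) (f : A → ℚ) → sumL xs (λ a → - f a) ≡ - sumL xs f
sumL-neg [] f = refl
sumL-neg (x ∷ xs) f rewrite sumL-neg xs f = sym (neg-distrib-+ (f x) _)

sumL-sub : (xs : List A) (f g : A → ℚ) → sumL xs (λ a → f a - g a) ≡ sumL xs f - sumL xs g
sumL-sub xs f g = trans (sumL-+ xs f (λ a → - g a)) (cong (sumL xs f +_) (sumL-neg xs g))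

sumL-swap : (xs : List A) (ys : List B) (f : A → B → ℚ) →
  sumL xs (λ a → sumL ys (f a)) ≡ sumL ys (λ b → sumL xs (λ a → f a b))
sumL-swap [] ys f = sym (sumL-0 ys)
sumL-swap (x ∷ xs) ys f rewrite sumL-swap xs ys f = sym (sumL-+ ys (f x) (λ b → sumL xs (λ a → f a b)))

sumL-tabulate : (k : ℕ) (g : Fin k → A) (f : A → ℚ) → sumL (tabulate g) f ≡ sumFin k (f ∘ g)
sumL-tabulate zero g f = refl
sumL-tabulate (suc k) g f =
  cong (f (g zero) +_) (trans (sumL-tabulate k (g ∘ suc) f) (sym (sumL-tabulate k suc (f ∘ g))))

sumFin-suc : (k : ℕ) (f : Fin (suc k) → ℚ) → sumFin (suc k) f ≡ f zero + sumFin k (f ∘ suc)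
sumFin-suc k f = cong (f zero +_) (sumL-tabulate k suc f)

δ : DecidableEquality A → A → A → ℚ
δ _≟_ a b = if does (a ≟ b) then 1ℚ else 0ℚ

module _ (_≟_ : DecidableEquality A) where

  δ-refl : (a : A) → δ _≟_ a a ≡ 1ℚ
  δ-refl a with a ≟ a
  ... | yes _  = refl
  ... | no a≢a = ⊥-elim (a≢a refl)

  δ-nonNeg : (a b : A) → 0ℚ ≤ δ _≟_ a b
  δ-nonNeg a b with does (a ≟ b)
  ... | true  = 0≤1
  ... | false = ≤-refl

sumFin-δ : (k : ℕ) (b : Fin k) (f : Fin k → ℚ) → sumFin k (λ a → δ _≟ᶠ_ a b * f a) ≡ f b
sumFin-δ (suc k) zero f = begin
  sumFin (suc k) (λ a → δ _≟ᶠ_ a zero * f a)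
    ≡⟨ sumFin-suc k (λ a → δ _≟ᶠ_ a zero * f a) ⟩
  1ℚ * f zero + sumFin k (λ a → 0ℚ * f (suc a))
    ≡⟨ cong₂ _+_ (*-identityˡ (f zero)) (sumL-≡0 (allFin k) (λ a _ → *-zeroˡ (f (suc a)))) ⟩
  f zero + 0ℚ
    ≡⟨ +-identityʳ (f zero) ⟩
  f zero ∎
  where open ≡-Reasoning
sumFin-δ (suc k) (suc b) f = begin
  sumFin (suc k) (λ a → δ _≟ᶠ_ a (suc b) * f a)
    ≡⟨ sumFin-suc k (λ a → δ _≟ᶠ_ a (suc b) * f a) ⟩
  0ℚ * f zero + sumFin k (λ a → δ _≟ᶠ_ (suc a) (suc b) * f (suc a))
    ≡⟨ cong₂ _+_ (*-zeroˡ (f zero)) (sumL-cong (allFin k) (λ a → cong (_* f (suc a)) (δ-suc a))) ⟩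
  0ℚ + sumFin k (λ a → δ _≟ᶠ_ a b * f (suc a))
    ≡⟨ +-identityˡ _ ⟩
  sumFin k (λ a → δ _≟ᶠ_ a b * f (suc a))
    ≡⟨ sumFin-δ k b (f ∘ suc) ⟩
  f (suc b) ∎
  where
  open ≡-Reasoning
  δ-suc : ∀ a → δ _≟ᶠ_ (suc a) (suc b) ≡ δ _≟ᶠ_ a b
  δ-suc a with a ≟ᶠ b
  ... | yes refl = refl
  ... | no _     = refl

sumFin-δ-1 : (k : ℕ) (b : Fin k) → sumFin k (λ a → δ _≟ᶠ_ a b) ≡ 1ℚ
sumFin-δ-1 k b = trans (sumL-cong (allFin k) (λ a → sym (*-identityʳ (δ _≟ᶠ_ a b)))) (sumFin-δ k b (λ _ → 1ℚ))

-- Sums and products over subsets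

-- sumIn G and prodIn G of Defs, which do not depend on G.
sumSub : Subset m → (Fin m → ℚ) → ℚ
sumSub {m} S f = sumFin m (λ u → if lookup S u then f u else 0ℚ)

prodSub : Subset m → (Fin m → ℚ) → ℚ
prodSub {m} S f = foldr (λ u r → (if lookup S u then f u else 1ℚ) * r) 1ℚ (allFin m)

prodL-tabulate : (k : ℕ) (g : Fin k → A) (f : A → ℚ) →
  foldr (λ a r → f a * r) 1ℚ (tabulate g) ≡ foldr (λ u r → f (g u) * r) 1ℚ (allFin k)
prodL-tabulate zero g f = refl
prodL-tabulate (suc k) g f =
  cong (f (g zero) *_) (trans (prodL-tabulate k (g ∘ suc) f) (sym (prodL-tabulate k suc (f ∘ g))))

sumSub-∷ : (s : Bool) (S : Subset m) (f : Fin (suc m) → ℚ) →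
  sumSub (s ∷ S) f ≡ (if s then f zero else 0ℚ) + sumSub S (f ∘ suc)
sumSub-∷ {m} s S f = sumFin-suc m (λ u → if lookup (s ∷ S) u then f u else 0ℚ)

prodSub-∷ : (s : Bool) (S : Subset m) (f : Fin (suc m) → ℚ) →
  prodSub (s ∷ S) f ≡ (if s then f zero else 1ℚ) * prodSub S (f ∘ suc)
prodSub-∷ {m} s S f = cong ((if s then f zero else 1ℚ) *_) (prodL-tabulate m suc (λ u → if lookup (s ∷ S) u then f u else 1ℚ))

sumSub-⊥ : (f : Fin m → ℚ) → sumSub ⊥ f ≡ 0ℚ
sumSub-⊥ {zero} f = refl
sumSub-⊥ {suc m} f = trans (sumSub-∷ false ⊥ f) (trans (+-identityˡ _) (sumSub-⊥ (f ∘ suc)))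

prodSub-⊥ : (f : Fin m → ℚ) → prodSub ⊥ f ≡ 1ℚ
prodSub-⊥ {zero} f = refl
prodSub-⊥ {suc m} f = trans (prodSub-∷ false ⊥ f) (trans (*-identityˡ _) (prodSub-⊥ (f ∘ suc)))

sumSub-split : {S : Subset m} {a : Fin m} (f : Fin m → ℚ) → a ∈ˢ S →
  sumSub S f ≡ f a + sumSub (S ∖ a) f
sumSub-split {S = _ ∷ S} f here = begin
  sumSub (true ∷ S) f                  ≡⟨ sumSub-∷ true S f ⟩
  f zero + sumSub S (f ∘ suc)          ≡⟨ cong (λ T → f zero + sumSub T (f ∘ suc)) (p─⊥≡p S) ⟨
  f zero + sumSub (S ─ ⊥) (f ∘ suc)           ≡⟨ cong (f zero +_) (+-identityˡ _) ⟨
  f zero + (0ℚ + sumSub (S ─ ⊥) (f ∘ suc))    ≡⟨ cong (f zero +_) (sumSub-∷ false (S ─ ⊥) f) ⟨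
  f zero + sumSub (false ∷ (S ─ ⊥)) f         ∎
  where open ≡-Reasoning
sumSub-split {S = s ∷ S} {suc a} f (there a∈S) = begin
  sumSub (s ∷ S) f                                  ≡⟨ sumSub-∷ s S f ⟩
  c + sumSub S (f ∘ suc)                            ≡⟨ cong (c +_) (sumSub-split (f ∘ suc) a∈S) ⟩
  c + (f (suc a) + sumSub (S ∖ a) (f ∘ suc))        ≡⟨ swap c (f (suc a)) _ ⟩
  f (suc a) + (c + sumSub (S ∖ a) (f ∘ suc))        ≡⟨ cong (f (suc a) +_) (sumSub-∷ s (S ∖ a) f) ⟨
  f (suc a) + sumSub (s ∷ (S ∖ a)) f                  ∎
  where
  open ≡-Reasoning
  c = if s then f zero else 0ℚ
  swap : ∀ a b c → a + (b + c) ≡ b + (a + c)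
  swap = solve-∀ ℚ-ring

prodSub-split : {S : Subset m} {a : Fin m} (f : Fin m → ℚ) → a ∈ˢ S →
  prodSub S f ≡ f a * prodSub (S ∖ a) f
prodSub-split {S = _ ∷ S} f here = begin
  prodSub (true ∷ S) f                  ≡⟨ prodSub-∷ true S f ⟩
  f zero * prodSub S (f ∘ suc)          ≡⟨ cong (λ T → f zero * prodSub T (f ∘ suc)) (p─⊥≡p S) ⟨
  f zero * prodSub (S ─ ⊥) (f ∘ suc)           ≡⟨ cong (f zero *_) (*-identityˡ _) ⟨
  f zero * (1ℚ * prodSub (S ─ ⊥) (f ∘ suc))    ≡⟨ cong (f zero *_) (prodSub-∷ false (S ─ ⊥) f) ⟨
  f zero * prodSub (false ∷ (S ─ ⊥)) f         ∎
  where open ≡-Reasoning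
prodSub-split {S = s ∷ S} {suc a} f (there a∈S) = begin
  prodSub (s ∷ S) f                                  ≡⟨ prodSub-∷ s S f ⟩
  c * prodSub S (f ∘ suc)                            ≡⟨ cong (c *_) (prodSub-split (f ∘ suc) a∈S) ⟩
  c * (f (suc a) * prodSub (S ∖ a) (f ∘ suc))        ≡⟨ swap c (f (suc a)) _ ⟩
  f (suc a) * (c * prodSub (S ∖ a) (f ∘ suc))        ≡⟨ cong (f (suc a) *_) (prodSub-∷ s (S ∖ a) f) ⟨
  f (suc a) * prodSub (s ∷ (S ∖ a)) f                  ∎
  where
  open ≡-Reasoning
  c = if s then f zero else 1ℚ
  swap : ∀ a b c → a * (b * c) ≡ b * (a * c)
  swap = solve-∀ ℚ-ring

sumSub-cong : (S : Subset m) {f g : Fin m → ℚ} → (∀ u → u ∈ˢ S → f u ≡ g u) → sumSub S f ≡ sumSub S g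
sumSub-cong {m} S {f} {g} f≡g = sumL-cong (allFin m) term
  where
  term : ∀ u → (if lookup S u then f u else 0ℚ) ≡ (if lookup S u then g u else 0ℚ)
  term u with lookup S u in eq
  ... | true  = f≡g u (lookup⇒[]= u S eq)
  ... | false = refl

sumSub-0 : (S : Subset m) → sumSub S (λ _ → 0ℚ) ≡ 0ℚ
sumSub-0 {m} S = sumL-≡0 (allFin m) term
  where
  term : ∀ u → u ∈ allFin m → (if lookup S u then 0ℚ else 0ℚ) ≡ 0ℚ
  term u _ with lookup S u
  ... | true  = refl
  ... | false = refl

sumSub-+ : (S : Subset m) (f g : Fin m → ℚ) → sumSub S (λ u → f u + g u) ≡ sumSub S f + sumSub S g
sumSub-+ {m} S f g =
  trans (sumL-cong (allFin m) term) (sumL-+ (allFin m) (λ u → if lookup S u then f u else 0ℚ) (λ u → if lookup S u then g u else 0ℚ))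
  where
  term : ∀ u → (if lookup S u then f u + g u else 0ℚ)
             ≡ (if lookup S u then f u else 0ℚ) + (if lookup S u then g u else 0ℚ)
  term u with lookup S u
  ... | true  = refl
  ... | false = sym (+-identityˡ 0ℚ)

sumSub-*ˡ : (S : Subset m) (k : ℚ) (f : Fin m → ℚ) → sumSub S (λ u → k * f u) ≡ k * sumSub S f
sumSub-*ˡ {m} S k f = trans (sumL-cong (allFin m) term) (sumL-*ˡ (allFin m) k (λ u → if lookup S u then f u else 0ℚ))
  where
  term : ∀ u → (if lookup S u then k * f u else 0ℚ) ≡ k * (if lookup S u then f u else 0ℚ)
  term u with lookup S u
  ... | true  = refl
  ... | false = sym (*-zeroʳ k)

sumSub-swap : (S : Subset m) (xs : List A) (f : Fin m → A → ℚ) →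
  sumSub S (λ u → sumL xs (f u)) ≡ sumL xs (λ a → sumSub S (λ u → f u a))
sumSub-swap {m} S xs f = trans (sumL-cong (allFin m) term) (sumL-swap (allFin m) xs (λ u a → if lookup S u then f u a else 0ℚ))
  where
  term : ∀ u → (if lookup S u then sumL xs (f u) else 0ℚ) ≡ sumL xs (λ a → if lookup S u then f u a else 0ℚ)
  term u with lookup S u
  ... | true  = refl
  ... | false = sym (sumL-0 xs)

prodSub-∈[0,1] : (S : Subset m) (f : Fin m → ℚ) → (∀ u → 0ℚ ≤ f u) → (∀ u → f u ≤ 1ℚ) →
  0ℚ ≤ prodSub S f × prodSub S f ≤ 1ℚ
prodSub-∈[0,1] [] f 0≤f f≤1 = 0≤1 , ≤-refl
prodSub-∈[0,1] (s ∷ S) f 0≤f f≤1 rewrite prodSub-∷ s S f =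
  *-nonNeg 0≤c 0≤P , ≤-trans (*-monoˡ-≤-0≤ 0≤c P≤1) (≤-trans (≤-reflexive (*-identityʳ c)) c≤1)
  where
  c = if s then f zero else 1ℚ
  head∈[0,1] : (s : Bool) → 0ℚ ≤ (if s then f zero else 1ℚ) × (if s then f zero else 1ℚ) ≤ 1ℚ
  head∈[0,1] true  = 0≤f zero , f≤1 zero
  head∈[0,1] false = 0≤1 , ≤-refl
  0≤c = proj₁ (head∈[0,1] s)
  c≤1 = proj₂ (head∈[0,1] s)
  0≤P = proj₁ (prodSub-∈[0,1] S (f ∘ suc) (0≤f ∘ suc) (f≤1 ∘ suc))
  P≤1 = proj₂ (prodSub-∈[0,1] S (f ∘ suc) (0≤f ∘ suc) (f≤1 ∘ suc))

positiveSet : (Fin m → ℚ) → Subset m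
positiveSet d = Vec.tabulate (λ u → does (0ℚ <? d u))

∈-positiveSet : (d : Fin m → ℚ) {u : Fin m} → u ∈ˢ positiveSet d → 0ℚ < d u
∈-positiveSet d {u} u∈ = extract (0ℚ <? d u) (trans (sym (lookup∘tabulate (λ u → does (0ℚ <? d u)) u)) ([]=⇒lookup u∈))
  where
  extract : (0<d? : Dec (0ℚ < d u)) → does 0<d? ≡ true → 0ℚ < d u
  extract (yes 0<d) _ = 0<d

sumFin≤sumSub-positiveSet : (d z : Fin m → ℚ) → (∀ u → 0ℚ ≤ z u) →
  sumFin m (λ u → d u * z u) ≤ sumSub (positiveSet d) (λ u → d u * z u)
sumFin≤sumSub-positiveSet {m} d z 0≤z = sumL-mono (allFin m) λ u →
  subst (λ s → d u * z u ≤ (if s then d u * z u else 0ℚ)) (sym (lookup∘tabulate (λ u → does (0ℚ <? d u)) u)) (term u (0ℚ <? d u))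
  where
  term : ∀ u (0<d? : Dec (0ℚ < d u)) → d u * z u ≤ (if does 0<d? then d u * z u else 0ℚ)
  term u (yes _)    = ≤-refl
  term u (no d≯0) = ≤-trans (*-monoʳ-≤-0≤ (0≤z u) (≮⇒≥ d≯0)) (≤-reflexive (*-zeroˡ (z u)))

x∉p∖x : (S : Subset m) (a : Fin m) → ¬ (a ∈ˢ S ∖ a)
x∉p∖x (s ∷ S) zero ()
x∉p∖x (s ∷ S) (suc a) (there a∈) = x∉p∖x S a a∈

argminSub : (S : Subset m) (f : Fin m → ℚ) {a₀ : Fin m} → a₀ ∈ˢ S →
  Σ (Fin m) λ a → a ∈ˢ S × (∀ u → u ∈ˢ S → f a ≤ f u)
argminSub {m} S f {a₀} a₀∈S =
  a , argmin-all f {xs = members} a₀∈S (All.tabulate (proj₂ ∘ ∈-filter⁻ (_∈? S) {xs = allFin m}))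
    , λ u u∈S → All.lookup (f[argmin]≤f[xs] a₀ members) (∈-filter⁺ (_∈? S) (∈-allFin u) u∈S)
  where
  members = List.filter (_∈? S) (allFin m)
  a = argmin f a₀ members

-- Fourier–Motzkin elimination

interpolate : (lo hi : List ℚ) → (∀ {a b} → a ∈ lo → b ∈ hi → a ≤ b) →
  Σ ℚ λ s → (∀ {a} → a ∈ lo → a ≤ s) × (∀ {b} → b ∈ hi → s ≤ b)
interpolate lo hi lo≤hi =
  min (max 0ℚ lo) hi
  , (λ a∈lo → v≤min⁺ (All.lookup (xs≤max 0ℚ lo) a∈lo) (All.tabulate (lo≤hi a∈lo)))
  , All.lookup (min≤xs (max 0ℚ lo) hi)

weighted : (A → ℚ) → List (ℚ × A) → ℚ
weighted F C = sumL C (λ (q , a) → q * F a)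

scale : ℚ → List (ℚ × A) → List (ℚ × A)
scale s = map (λ (q , a) → (s * q , a))

weighted-scale : (F : A → ℚ) (s : ℚ) (C : List (ℚ × A)) → weighted F (scale s C) ≡ s * weighted F C
weighted-scale F s C = begin
  weighted F (scale s C)                   ≡⟨ sumL-map _ C (λ (q , a) → q * F a) ⟩
  sumL C (λ (q , a) → s * q * F a)         ≡⟨ sumL-cong C (λ (q , a) → *-assoc s q (F a)) ⟩
  sumL C (λ (q , a) → s * (q * F a))       ≡⟨ sumL-*ˡ C s (λ (q , a) → q * F a) ⟩
  s * weighted F C                         ∎
  where open ≡-Reasoning

weighted-+ : (F F′ : A → ℚ) (C : List (ℚ × A)) → weighted (λ a → F a + F′ a) C ≡ weighted F C + weighted F′ C
weighted-+ F F′ C = trans (sumL-cong C (λ (q , a) → *-distribˡ-+ q (F a) (F′ a))) (sumL-+ C (λ (q , a) → q * F a) (λ (q , a) → q * F′ a))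

weighted-sumL : (xs : List B) (H : B → A → ℚ) (C : List (ℚ × A)) →
  weighted (λ a → sumL xs (λ x → H x a)) C ≡ sumL xs (λ x → weighted (H x) C)
weighted-sumL xs H C = trans (sumL-cong C (λ (q , a) → sym (sumL-*ˡ xs q (λ x → H x a))))
                             (sumL-swap C xs (λ (q , a) x → q * H x a))

weighted-*ʳ : (F : A → ℚ) (s : ℚ) (C : List (ℚ × A)) → weighted (λ a → F a * s) C ≡ weighted F C * s
weighted-*ʳ F s C = trans (sumL-cong C (λ (q , a) → sym (*-assoc q (F a) s))) (sumL-*ʳ C s (λ (q , a) → q * F a))

weighted-mono : (C : List (ℚ × A)) → (∀ {q a} → (q , a) ∈ C → 0ℚ ≤ q) → {F F′ : A → ℚ} → (∀ a → F a ≤ F′ a) →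
  weighted F C ≤ weighted F′ C
weighted-mono C 0≤q F≤F′ = sumL-mono-∈ C (λ (q , a) qa∈ → *-monoˡ-≤-0≤ (0≤q qa∈) (F≤F′ a))

weighted-nonNeg : (C : List (ℚ × A)) → (∀ {q a} → (q , a) ∈ C → 0ℚ ≤ q) → {F : A → ℚ} → (∀ a → 0ℚ ≤ F a) →
  0ℚ ≤ weighted F C
weighted-nonNeg C 0≤q 0≤F = sumL-nonNeg C (λ (q , a) qa∈ → *-nonNeg (0≤q qa∈) (0≤F a))

record Ineq (I : Set) : Set where
  field
    tcoeff : ℚ
    xcoeff : I → ℚ
    rhs    : ℚ

open Ineq

-- Inequalities  tcoeff * t + Σ_{i ∈ vars} xcoeff i * x i ≤ rhs  in an auxiliary variable t and x : I → ℚ.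
-- Repetitions in vars are allowed; x i then simply carries the weight of its multiplicity.
module FourierMotzkin {I K : Set} (_≟ᵥ_ : DecidableEquality I) (vars : List I)
                      (row : K → Ineq I) (InSystem : K → Set) where

  dot : (I → ℚ) → (I → ℚ) → ℚ
  dot a x = sumL vars (λ i → a i * x i)

  dot-cong : {a b : I → ℚ} (x : I → ℚ) → (∀ i → a i ≡ b i) → dot a x ≡ dot b x
  dot-cong x a≡b = sumL-cong vars (λ i → cong (_* x i) (a≡b i))

  dot-congʳ : (a : I → ℚ) {x y : I → ℚ} → (∀ i → x i ≡ y i) → dot a x ≡ dot a y
  dot-congʳ a x≡y = sumL-cong vars (λ i → cong (a i *_) (x≡y i))

  dot-+ : (a b x : I → ℚ) → dot (λ i → a i + b i) x ≡ dot a x + dot b x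
  dot-+ a b x = trans (sumL-cong vars (λ i → *-distribʳ-+ (x i) (a i) (b i)))
                      (sumL-+ vars (λ i → a i * x i) (λ i → b i * x i))

  dot-*ˡ : (s : ℚ) (a x : I → ℚ) → dot (λ i → s * a i) x ≡ s * dot a x
  dot-*ˡ s a x = trans (sumL-cong vars (λ i → *-assoc s (a i) (x i))) (sumL-*ˡ vars s (λ i → a i * x i))

  dot-neg : (a x : I → ℚ) → dot (λ i → - a i) x ≡ - dot a x
  dot-neg a x = trans (sumL-cong vars (λ i → sym (neg-distribˡ-* (a i) (x i)))) (sumL-neg vars (λ i → a i * x i))

  dot-≡0 : (a x : I → ℚ) → (∀ i → i ∈ vars → a i ≡ 0ℚ) → dot a x ≡ 0ℚ
  dot-≡0 a x a≡0 = sumL-≡0 vars (λ i i∈ → trans (cong (_* x i) (a≡0 i i∈)) (*-zeroˡ (x i)))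

  Holds : ℚ → (I → ℚ) → Ineq I → Set
  Holds t x ι = tcoeff ι * t + dot (xcoeff ι) x ≤ rhs ι

  holds-resp : {t : ℚ} {x : I → ℚ} {ι ι′ : Ineq I} → tcoeff ι ≡ tcoeff ι′ → (∀ i → xcoeff ι i ≡ xcoeff ι′ i) →
    rhs ι ≡ rhs ι′ → Holds t x ι → Holds t x ι′
  holds-resp {t} {x} T≡ a≡ r≡ = subst₂ _≤_ (cong₂ (λ T d → T * t + d) T≡ (dot-cong x a≡)) r≡

  Combination : Set
  Combination = List (ℚ × K)

  combined : Combination → Ineq I
  combined C = record
    { tcoeff = weighted (tcoeff ∘ row) C
    ; xcoeff = λ i → weighted (λ k → xcoeff (row k) i) C
    ; rhs    = weighted (rhs ∘ row) C
    }

  Admissible : Combination → Set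
  Admissible C = ∀ {q k} → (q , k) ∈ C → 0ℚ ≤ q × InSystem k

  combined-holds : {t : ℚ} {x : I → ℚ} → (∀ k → InSystem k → Holds t x (row k)) →
    (C : Combination) → Admissible C → Holds t x (combined C)
  combined-holds {t} {x} rows-hold [] _ = ≤-reflexive (begin
    0ℚ * t + dot (λ _ → 0ℚ) x     ≡⟨ cong₂ _+_ (*-zeroˡ t) (dot-≡0 (λ _ → 0ℚ) x (λ _ _ → refl)) ⟩
    0ℚ + 0ℚ                        ≡⟨ +-identityˡ 0ℚ ⟩
    0ℚ                             ∎)
    where open ≡-Reasoning
  combined-holds {t} {x} rows-hold ((q , k) ∷ C) adm = begin
    (q * T + T′) * t + dot (λ i → q * a i + a′ i) x
      ≡⟨ cong ((q * T + T′) * t +_) (dot-+ (λ i → q * a i) a′ x) ⟩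
    (q * T + T′) * t + (dot (λ i → q * a i) x + dot a′ x)
      ≡⟨ cong (λ d → (q * T + T′) * t + (d + dot a′ x)) (dot-*ˡ q a x) ⟩
    (q * T + T′) * t + (q * dot a x + dot a′ x)
      ≡⟨ regroup q T T′ t (dot a x) (dot a′ x) ⟩
    q * (T * t + dot a x) + (T′ * t + dot a′ x)
      ≤⟨ +-mono-≤ (*-monoˡ-≤-0≤ 0≤q (rows-hold k k∈)) (combined-holds rows-hold C (adm ∘ there)) ⟩
    q * rhs (row k) + weighted (rhs ∘ row) C ∎
    where
    open ≤-Reasoning
    T  = tcoeff (row k)
    T′ = weighted (tcoeff ∘ row) C
    a  = xcoeff (row k)
    a′ = xcoeff (combined C)
    0≤q = proj₁ (adm (here refl))
    k∈  = proj₂ (adm (here refl))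
    regroup : ∀ q T T′ t d d′ → (q * T + T′) * t + (q * d + d′) ≡ q * (T * t + d) + (T′ * t + d′)
    regroup = solve-∀ ℚ-ring

  merge : ℚ → Combination → ℚ → Combination → Combination
  merge s P s′ N = scale s P ++ scale s′ N

  weighted-merge : (F : K → ℚ) (s : ℚ) (P : Combination) (s′ : ℚ) (N : Combination) →
    weighted F (merge s P s′ N) ≡ s * weighted F P + s′ * weighted F N
  weighted-merge F s P s′ N =
    trans (sumL-++ (scale s P) (scale s′ N) (λ (q , k) → q * F k)) (cong₂ _+_ (weighted-scale F s P) (weighted-scale F s′ N))

  merge-admissible : {s s′ : ℚ} {P N : Combination} → 0ℚ ≤ s → 0ℚ ≤ s′ → Admissible P → Admissible N →
    Admissible (merge s P s′ N)
  merge-admissible {s} {s′} {P} 0≤s 0≤s′ admP admN qk∈ with ∈-++⁻ (scale s P) qk∈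
  ... | inj₁ qk∈sP with ∈-map⁻ (λ (q , k) → (s * q , k)) qk∈sP
  ...   | _ , qk∈P , refl = *-nonNeg 0≤s (proj₁ (admP qk∈P)) , proj₂ (admP qk∈P)
  merge-admissible {s} {s′} 0≤s 0≤s′ admP admN qk∈ | inj₂ qk∈sN with ∈-map⁻ (λ (q , k) → (s′ * q , k)) qk∈sN
  ...   | _ , qk∈N , refl = *-nonNeg 0≤s′ (proj₁ (admN qk∈N)) , proj₂ (admN qk∈N)

  coeff : I → Combination → ℚ
  coeff j C = xcoeff (combined C) j

  zeros positives negatives : I → List Combination → List Combination
  zeros     j = List.filter (λ C → coeff j C ≟ 0ℚ)
  positives j = List.filter (λ C → 0ℚ <? coeff j C)
  negatives j = List.filter (λ C → coeff j C <? 0ℚ)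

  pair : I → Combination → Combination → Combination
  pair j P N = merge (- coeff j N) P (coeff j P) N

  coeff-pair : (j i : I) (P N : Combination) → coeff i (pair j P N) ≡ (- coeff j N) * coeff i P + coeff j P * coeff i N
  coeff-pair j i P N = weighted-merge (λ k → xcoeff (row k) i) (- coeff j N) P (coeff j P) N

  eliminate : I → List Combination → List Combination
  eliminate j Cs = zeros j Cs ++ concatMap (λ P → map (pair j P) (negatives j Cs)) (positives j Cs)

  module _ {j : I} (Cs : List Combination) {C : Combination} where

    ∈-zeros⁻ : C ∈ zeros j Cs → C ∈ Cs × coeff j C ≡ 0ℚ
    ∈-zeros⁻ = ∈-filter⁻ (λ C → coeff j C ≟ 0ℚ) {xs = Cs}

    ∈-positives⁻ : C ∈ positives j Cs → C ∈ Cs × 0ℚ < coeff j C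
    ∈-positives⁻ = ∈-filter⁻ (λ C → 0ℚ <? coeff j C) {xs = Cs}

    ∈-negatives⁻ : C ∈ negatives j Cs → C ∈ Cs × coeff j C < 0ℚ
    ∈-negatives⁻ = ∈-filter⁻ (λ C → coeff j C <? 0ℚ) {xs = Cs}

    ∈-zeros⁺ : C ∈ Cs → coeff j C ≡ 0ℚ → C ∈ zeros j Cs
    ∈-zeros⁺ = ∈-filter⁺ (λ C → coeff j C ≟ 0ℚ)

    ∈-positives⁺ : C ∈ Cs → 0ℚ < coeff j C → C ∈ positives j Cs
    ∈-positives⁺ = ∈-filter⁺ (λ C → 0ℚ <? coeff j C)

    ∈-negatives⁺ : C ∈ Cs → coeff j C < 0ℚ → C ∈ negatives j Cs
    ∈-negatives⁺ = ∈-filter⁺ (λ C → coeff j C <? 0ℚ)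

  module _ (j : I) (Cs : List Combination) where

    ∈-eliminate⁻ : {C : Combination} → C ∈ eliminate j Cs →
      C ∈ zeros j Cs ⊎ ∃₂ λ P N → P ∈ positives j Cs × N ∈ negatives j Cs × C ≡ pair j P N
    ∈-eliminate⁻ C∈ with ∈-++⁻ (zeros j Cs) C∈
    ... | inj₁ C∈zeros = inj₁ C∈zeros
    ... | inj₂ C∈pairs with find (∈-concatMap⁻ (λ P → map (pair j P) (negatives j Cs)) C∈pairs)
    ...   | P , P∈ , C∈pairsP with ∈-map⁻ (pair j P) C∈pairsP
    ...     | N , N∈ , refl = inj₂ (P , N , P∈ , N∈ , refl)

    pair∈eliminate : {P N : Combination} → P ∈ positives j Cs → N ∈ negatives j Cs → pair j P N ∈ eliminate j Cs
    pair∈eliminate {P} P∈ N∈ = ∈-++⁺ʳ (zeros j Cs)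
      (∈-concatMap⁺ (λ P → map (pair j P) (negatives j Cs)) (lose P∈ (∈-map⁺ (pair j P) N∈)))

    eliminate-admissible : (∀ {C} → C ∈ Cs → Admissible C) → ∀ {C} → C ∈ eliminate j Cs → Admissible C
    eliminate-admissible adm C∈ with ∈-eliminate⁻ C∈
    ... | inj₁ C∈zeros = adm (proj₁ (∈-zeros⁻ Cs C∈zeros))
    ... | inj₂ (P , N , P∈ , N∈ , refl) with ∈-positives⁻ Cs P∈ | ∈-negatives⁻ Cs N∈
    ...   | P∈Cs , 0<aP | N∈Cs , aN<0 = merge-admissible (neg-antimono-≤ (<⇒≤ aN<0)) (<⇒≤ 0<aP) (adm P∈Cs) (adm N∈Cs)

    eliminate-preserves-zero : {i : I} → (∀ {C} → C ∈ Cs → coeff i C ≡ 0ℚ) → ∀ {C} → C ∈ eliminate j Cs → coeff i C ≡ 0ℚ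
    eliminate-preserves-zero {i} a≡0 C∈ with ∈-eliminate⁻ C∈
    ... | inj₁ C∈zeros = a≡0 (proj₁ (∈-zeros⁻ Cs C∈zeros))
    ... | inj₂ (P , N , P∈ , N∈ , refl) = begin
      coeff i (pair j P N)                              ≡⟨ coeff-pair j i P N ⟩
      (- coeff j N) * coeff i P + coeff j P * coeff i N ≡⟨ cong₂ (λ a b → (- coeff j N) * a + coeff j P * b)
                                                             (a≡0 (proj₁ (∈-positives⁻ Cs P∈))) (a≡0 (proj₁ (∈-negatives⁻ Cs N∈))) ⟩
      (- coeff j N) * 0ℚ + coeff j P * 0ℚ               ≡⟨ vanish (coeff j N) (coeff j P) ⟩
      0ℚ                                                ∎
      where
      open ≡-Reasoning
      vanish : ∀ a b → (- a) * 0ℚ + b * 0ℚ ≡ 0ℚ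
      vanish = solve-∀ ℚ-ring

    eliminate-zero : ∀ {C} → C ∈ eliminate j Cs → coeff j C ≡ 0ℚ
    eliminate-zero C∈ with ∈-eliminate⁻ C∈
    ... | inj₁ C∈zeros = proj₂ (∈-zeros⁻ Cs C∈zeros)
    ... | inj₂ (P , N , _ , _ , refl) = trans (coeff-pair j j P N) (cancel (coeff j N) (coeff j P))
      where
      cancel : ∀ a b → (- a) * b + b * a ≡ 0ℚ
      cancel = solve-∀ ℚ-ring

  update : (I → ℚ) → I → ℚ → I → ℚ
  update x j s i = if does (i ≟ᵥ j) then s else x i

  update-self : (x : I → ℚ) (j i : I) → x i ≡ update x j (x j) i
  update-self x j i with i ≟ᵥ j
  ... | yes refl = refl
  ... | no _     = refl

  multiplicity : I → ℚ
  multiplicity j = sumL vars (λ i → δ _≟ᵥ_ i j)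

  multiplicity-pos : {j : I} → j ∈ vars → 0ℚ < multiplicity j
  multiplicity-pos {j} j∈ = <-≤-trans (positive⁻¹ 1ℚ) (1≤count vars j∈)
    where
    1≤count : (xs : List I) → j ∈ xs → 1ℚ ≤ sumL xs (λ i → δ _≟ᵥ_ i j)
    1≤count (i ∷ xs) (here refl) = begin
      1ℚ                   ≡⟨ +-identityʳ 1ℚ ⟨
      1ℚ + 0ℚ              ≤⟨ +-mono-≤ (≤-reflexive (sym (δ-refl _≟ᵥ_ i))) (sumL-nonNeg xs (λ i _ → δ-nonNeg _≟ᵥ_ i j)) ⟩
      δ _≟ᵥ_ i i + sumL xs (λ i → δ _≟ᵥ_ i j) ∎
      where open ≤-Reasoning
    1≤count (i ∷ xs) (there j∈) = begin
      1ℚ                   ≡⟨ +-identityˡ 1ℚ ⟨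
      0ℚ + 1ℚ              ≤⟨ +-mono-≤ (δ-nonNeg _≟ᵥ_ i j) (1≤count xs j∈) ⟩
      δ _≟ᵥ_ i j + sumL xs (λ i → δ _≟ᵥ_ i j) ∎
      where open ≤-Reasoning

  dot-δ : (j : I) (x : I → ℚ) → dot (λ i → δ _≟ᵥ_ i j) x ≡ multiplicity j * x j
  dot-δ j x = trans (sumL-cong vars term) (sumL-*ʳ vars (x j) (λ i → δ _≟ᵥ_ i j))
    where
    term : ∀ i → δ _≟ᵥ_ i j * x i ≡ δ _≟ᵥ_ i j * x j
    term i with i ≟ᵥ j
    ... | yes refl = refl
    ... | no _     = trans (*-zeroˡ (x i)) (sym (*-zeroˡ (x j)))

  dot-update : (a x : I → ℚ) (j : I) (s : ℚ) →
    dot a (update x j s) ≡ dot a (update x j 0ℚ) + a j * multiplicity j * s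
  dot-update a x j s = begin
    dot a (update x j s)
      ≡⟨ sumL-cong vars term ⟩
    sumL vars (λ i → a i * update x j 0ℚ i + a j * s * δ _≟ᵥ_ i j)
      ≡⟨ sumL-+ vars (λ i → a i * update x j 0ℚ i) (λ i → a j * s * δ _≟ᵥ_ i j) ⟩
    dot a (update x j 0ℚ) + sumL vars (λ i → a j * s * δ _≟ᵥ_ i j)
      ≡⟨ cong (dot a (update x j 0ℚ) +_) (sumL-*ˡ vars (a j * s) (λ i → δ _≟ᵥ_ i j)) ⟩
    dot a (update x j 0ℚ) + a j * s * multiplicity j
      ≡⟨ cong (dot a (update x j 0ℚ) +_) (reorder (a j) s (multiplicity j)) ⟩
    dot a (update x j 0ℚ) + a j * multiplicity j * s ∎
    where
    open ≡-Reasoning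
    reorder : ∀ a s m → a * s * m ≡ a * m * s
    reorder = solve-∀ ℚ-ring
    term : ∀ i → a i * update x j s i ≡ a i * update x j 0ℚ i + a j * s * δ _≟ᵥ_ i j
    term i with i ≟ᵥ j
    ... | yes refl = on-j (a i) s
      where
      on-j : ∀ a s → a * s ≡ a * 0ℚ + a * s * 1ℚ
      on-j = solve-∀ ℚ-ring
    ... | no _ = off-j (a i) (x i) (a j * s)
      where
      off-j : ∀ a y c → a * y ≡ a * y + c * 0ℚ
      off-j = solve-∀ ℚ-ring

  -- Fix everything but x j; an inequality then reads  slope * x j ≤ slack.
  module Lift (j : I) (t : ℚ) (x : I → ℚ) where

    slope : Ineq I → ℚ
    slope ι = xcoeff ι j * multiplicity j

    slack : Ineq I → ℚ
    slack ι = rhs ι - (tcoeff ι * t + dot (xcoeff ι) (update x j 0ℚ))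

    holds-update : (ι : Ineq I) {s : ℚ} → slope ι * s ≤ slack ι → Holds t (update x j s) ι
    holds-update ι {s} s≤ = begin
      tcoeff ι * t + dot (xcoeff ι) (update x j s)
        ≡⟨ cong (tcoeff ι * t +_) (dot-update (xcoeff ι) x j s) ⟩
      tcoeff ι * t + (dot (xcoeff ι) (update x j 0ℚ) + slope ι * s)
        ≡⟨ regroup (tcoeff ι * t) (dot (xcoeff ι) (update x j 0ℚ)) (slope ι * s) ⟩
      (tcoeff ι * t + dot (xcoeff ι) (update x j 0ℚ)) + slope ι * s
        ≤⟨ q≤r-p⇒p+q≤r s≤ ⟩
      rhs ι ∎
      where
      open ≤-Reasoning
      regroup : ∀ a b c → a + (b + c) ≡ a + b + c
      regroup = solve-∀ ℚ-ring

    holds⇒slope≤slack : (ι : Ineq I) → Holds t x ι → slope ι * x j ≤ slack ι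
    holds⇒slope≤slack ι holds = p+q≤r⇒q≤r-p (begin
      (tcoeff ι * t + dot (xcoeff ι) (update x j 0ℚ)) + slope ι * x j
        ≡⟨ regroup (tcoeff ι * t) (dot (xcoeff ι) (update x j 0ℚ)) (slope ι * x j) ⟩
      tcoeff ι * t + (dot (xcoeff ι) (update x j 0ℚ) + slope ι * x j)
        ≡⟨ cong (tcoeff ι * t +_) (dot-update (xcoeff ι) x j (x j)) ⟨
      tcoeff ι * t + dot (xcoeff ι) (update x j (x j))
        ≡⟨ cong (tcoeff ι * t +_) (dot-congʳ (xcoeff ι) (update-self x j)) ⟨
      tcoeff ι * t + dot (xcoeff ι) x
        ≤⟨ holds ⟩
      rhs ι ∎)
      where
      open ≤-Reasoning
      regroup : ∀ a b c → a + b + c ≡ a + (b + c)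
      regroup = solve-∀ ℚ-ring

    slack-merge : (s s′ : ℚ) (P N : Combination) →
      slack (combined (merge s P s′ N)) ≡ s * slack (combined P) + s′ * slack (combined N)
    slack-merge s s′ P N = begin
      slack (combined (merge s P s′ N))
        ≡⟨ cong₂ (λ r l → r - l) (weighted-merge (rhs ∘ row) s P s′ N)
                                 (cong₂ (λ T d → T * t + d) (weighted-merge (tcoeff ∘ row) s P s′ N) dot-merge) ⟩
      (s * rP + s′ * rN) - ((s * TP + s′ * TN) * t + (s * dP + s′ * dN))
        ≡⟨ distribute s s′ rP rN TP TN t dP dN ⟩
      s * (rP - (TP * t + dP)) + s′ * (rN - (TN * t + dN)) ∎
      where
      open ≡-Reasoning
      y  = update x j 0ℚ
      rP = rhs (combined P) ; rN = rhs (combined N)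
      TP = tcoeff (combined P) ; TN = tcoeff (combined N)
      dP = dot (xcoeff (combined P)) y ; dN = dot (xcoeff (combined N)) y
      dot-merge : dot (xcoeff (combined (merge s P s′ N))) y ≡ s * dP + s′ * dN
      dot-merge = begin
        dot (xcoeff (combined (merge s P s′ N))) y
          ≡⟨ dot-cong y (λ i → weighted-merge (λ k → xcoeff (row k) i) s P s′ N) ⟩
        dot (λ i → s * xcoeff (combined P) i + s′ * xcoeff (combined N) i) y
          ≡⟨ dot-+ (λ i → s * xcoeff (combined P) i) (λ i → s′ * xcoeff (combined N) i) y ⟩
        dot (λ i → s * xcoeff (combined P) i) y + dot (λ i → s′ * xcoeff (combined N) i) y
          ≡⟨ cong₂ _+_ (dot-*ˡ s (xcoeff (combined P)) y) (dot-*ˡ s′ (xcoeff (combined N)) y) ⟩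
        s * dP + s′ * dN ∎
      distribute : ∀ s s′ rP rN TP TN t dP dN →
        (s * rP + s′ * rN) - ((s * TP + s′ * TN) * t + (s * dP + s′ * dN)) ≡ s * (rP - (TP * t + dP)) + s′ * (rN - (TN * t + dN))
      distribute = solve-∀ ℚ-ring

    pair-slack : (P N : Combination) → Holds t x (combined (pair j P N)) →
      0ℚ ≤ (- coeff j N) * slack (combined P) + coeff j P * slack (combined N)
    pair-slack P N holds = begin
      0ℚ                                                ≡⟨ no-slope ⟨
      slope (combined (pair j P N)) * x j               ≤⟨ holds⇒slope≤slack (combined (pair j P N)) holds ⟩
      slack (combined (pair j P N))                     ≡⟨ slack-merge (- coeff j N) (coeff j P) P N ⟩
      (- coeff j N) * slack (combined P) + coeff j P * slack (combined N) ∎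
      where
      open ≤-Reasoning
      no-slope : slope (combined (pair j P N)) * x j ≡ 0ℚ
      no-slope rewrite coeff-pair j j P N = cancel (coeff j N) (coeff j P) (multiplicity j) (x j)
        where
        cancel : ∀ a b k y → ((- a) * b + b * a) * k * y ≡ 0ℚ
        cancel = solve-∀ ℚ-ring

    bound : Combination → ℚ
    bound C = slack (combined C) * recip (slope (combined C))

    lower≤upper : (P N : Combination) → 0ℚ < coeff j P → coeff j N < 0ℚ → 0ℚ < multiplicity j →
      Holds t x (combined (pair j P N)) → bound N ≤ bound P
    lower≤upper P N 0<aP aN<0 0<κ holds = *≤⇒≤*recip 0<cP (*-cancelˡ-≤-0< 0<-cN (begin
      (- cN) * (cP * bound N)
        ≡⟨ swap cN cP (bound N) ⟩
      - (cP * (cN * bound N))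
        ≡⟨ cong (λ z → - (cP * z)) (*-*recip (<-≢0 cN<0)) ⟩
      - (cP * sN)
        ≤⟨ 0≤q-p⇒p≤q (≤-trans (*-nonNeg (<⇒≤ 0<κ) (pair-slack P N holds))
                               (≤-reflexive (expand (coeff j N) (coeff j P) κ sP sN))) ⟩
      (- cN) * sP ∎))
      where
      open ≤-Reasoning
      κ  = multiplicity j
      cP = slope (combined P) ; cN = slope (combined N)
      sP = slack (combined P) ; sN = slack (combined N)
      0<cP : 0ℚ < cP
      0<cP = *-pos 0<aP 0<κ
      cN<0 : cN < 0ℚ
      cN<0 = *-neg-pos aN<0 0<κ
      0<-cN : 0ℚ < - cN
      0<-cN = neg-antimono-< cN<0
      swap : ∀ a b c → (- a) * (b * c) ≡ - (b * (a * c))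
      swap = solve-∀ ℚ-ring
      expand : ∀ aN aP κ sP sN → κ * ((- aN) * sP + aP * sN) ≡ (- (aN * κ)) * sP - (- (aP * κ * sN))
      expand = solve-∀ ℚ-ring

  eliminate-lift : {j : I} → j ∈ vars → (Cs : List Combination) {t : ℚ} {x : I → ℚ} →
    (∀ {C} → C ∈ eliminate j Cs → Holds t x (combined C)) →
    Σ (I → ℚ) λ x′ → ∀ {C} → C ∈ Cs → Holds t x′ (combined C)
  eliminate-lift {j} j∈ Cs {t} {x} holds = update x j s , lifted
    where
    open Lift j t x
    0<κ = multiplicity-pos j∈
    bounds-separated : ∀ {a b} → a ∈ map bound (negatives j Cs) → b ∈ map bound (positives j Cs) → a ≤ b
    bounds-separated a∈ b∈ with ∈-map⁻ bound a∈ | ∈-map⁻ bound b∈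
    ... | N , N∈ , refl | P , P∈ , refl =
      lower≤upper P N (proj₂ (∈-positives⁻ Cs P∈)) (proj₂ (∈-negatives⁻ Cs N∈)) 0<κ (holds (pair∈eliminate j Cs P∈ N∈))
    separated = interpolate (map bound (negatives j Cs)) (map bound (positives j Cs)) bounds-separated
    s = proj₁ separated
    lifted : ∀ {C} → C ∈ Cs → Holds t (update x j s) (combined C)
    lifted {C} C∈ with <-cmp (coeff j C) 0ℚ
    ... | tri< aC<0 _ _ = holds-update (combined C)
      (*recip≤⇒*≤ (*-neg-pos aC<0 0<κ) (proj₁ (proj₂ separated) (∈-map⁺ bound (∈-negatives⁺ Cs C∈ aC<0))))
    ... | tri> _ _ 0<aC = holds-update (combined C)
      (≤*recip⇒*≤ (*-pos 0<aC 0<κ) (proj₂ (proj₂ separated) (∈-map⁺ bound (∈-positives⁺ Cs C∈ 0<aC))))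
    ... | tri≈ _ aC≡0 _ = holds-update (combined C) (begin
      slope (combined C) * s      ≡⟨ flat s ⟩
      0ℚ                          ≡⟨ flat (x j) ⟨
      slope (combined C) * x j    ≤⟨ holds⇒slope≤slack (combined C) (holds (∈-++⁺ˡ (∈-zeros⁺ Cs C∈ aC≡0))) ⟩
      slack (combined C)          ∎)
      where
      open ≤-Reasoning
      flat : ∀ y → slope (combined C) * y ≡ 0ℚ
      flat y rewrite aC≡0 = trans (cong (_* y) (*-zeroˡ (multiplicity j))) (*-zeroˡ y)

  eliminateAll : List I → List Combination → List Combination
  eliminateAll []       Cs = Cs
  eliminateAll (j ∷ js) Cs = eliminateAll js (eliminate j Cs)

  eliminateAll-admissible : (js : List I) {Cs : List Combination} → (∀ {C} → C ∈ Cs → Admissible C) →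
    ∀ {C} → C ∈ eliminateAll js Cs → Admissible C
  eliminateAll-admissible []       adm = adm
  eliminateAll-admissible (j ∷ js) {Cs} adm = eliminateAll-admissible js (eliminate-admissible j Cs adm)

  eliminateAll-preserves-zero : (js : List I) {Cs : List Combination} {i : I} → (∀ {C} → C ∈ Cs → coeff i C ≡ 0ℚ) →
    ∀ {C} → C ∈ eliminateAll js Cs → coeff i C ≡ 0ℚ
  eliminateAll-preserves-zero []       a≡0 = a≡0
  eliminateAll-preserves-zero (j ∷ js) {Cs} a≡0 = eliminateAll-preserves-zero js (eliminate-preserves-zero j Cs a≡0)

  eliminateAll-zero : {js : List I} {Cs : List Combination} {i : I} → i ∈ js → ∀ {C} → C ∈ eliminateAll js Cs → coeff i C ≡ 0ℚ
  eliminateAll-zero {j ∷ js} {Cs} (here refl) = eliminateAll-preserves-zero js (eliminate-zero j Cs)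
  eliminateAll-zero {j ∷ js} {Cs} (there i∈)  = eliminateAll-zero {js} {eliminate j Cs} i∈

  eliminateAll-lift : (js : List I) → (∀ {j} → j ∈ js → j ∈ vars) → (Cs : List Combination) {t : ℚ} {x : I → ℚ} →
    (∀ {C} → C ∈ eliminateAll js Cs → Holds t x (combined C)) →
    Σ (I → ℚ) λ x′ → ∀ {C} → C ∈ Cs → Holds t x′ (combined C)
  eliminateAll-lift []       _   Cs holds = _ , holds
  eliminateAll-lift (j ∷ js) js⊆ Cs holds =
    let _ , holds₁ = eliminateAll-lift js (js⊆ ∘ there) (eliminate j Cs) holds
    in eliminate-lift (js⊆ (here refl)) Cs holds₁

-- Linear programming duality

module LinearProgram {I J : Set} (_≟ᵥ_ : DecidableEquality I) (vars : List I) (cons : List J)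
                     (A : J → I → ℚ) (b : J → ℚ) (c : I → ℚ) where

  -- The objective enters Fourier–Motzkin as the extra row  t - dot c x ≤ 0.
  row : Maybe J → Ineq I
  row nothing  = record { tcoeff = 1ℚ ; xcoeff = λ i → - c i ; rhs = 0ℚ }
  row (just r) = record { tcoeff = 0ℚ ; xcoeff = A r ; rhs = b r }

  InSystem : Maybe J → Set
  InSystem nothing  = ⊤
  InSystem (just r) = r ∈ cons

  module FM = FourierMotzkin _≟ᵥ_ vars row InSystem
  open FM
  open FM public using (dot; dot-neg; dot-δ; multiplicity; multiplicity-pos)

  Feasible : (I → ℚ) → Set
  Feasible x = ∀ {r} → r ∈ cons → dot (A r) x ≤ b r

  objective : (I → ℚ) → ℚ
  objective = dot c

  record DualCertificate : Set where
    field
      multipliers : List (ℚ × J)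
      admissible  : ∀ {y r} → (y , r) ∈ multipliers → 0ℚ ≤ y × r ∈ cons
      balanced    : ∀ {i} → i ∈ vars → weighted (λ r → A r i) multipliers ≡ c i

    value : ℚ
    value = weighted b multipliers

  open DualCertificate public

  weak-duality : (D : DualCertificate) {x : I → ℚ} → Feasible x → objective x ≤ value D
  weak-duality D {x} feasible = begin
    sumL vars (λ i → c i * x i)
      ≡⟨ sumL-cong-∈ vars (λ i i∈ → cong (_* x i) (balanced D i∈)) ⟨
    sumL vars (λ i → sumL ys (λ (y , r) → y * A r i) * x i)
      ≡⟨ sumL-cong vars (λ i → sumL-*ʳ ys (x i) (λ (y , r) → y * A r i)) ⟨
    sumL vars (λ i → sumL ys (λ (y , r) → y * A r i * x i))
      ≡⟨ sumL-swap vars ys (λ i (y , r) → y * A r i * x i) ⟩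
    sumL ys (λ (y , r) → sumL vars (λ i → y * A r i * x i))
      ≡⟨ sumL-cong ys (λ (y , r) → trans (sumL-cong vars (λ i → *-assoc y (A r i) (x i))) (sumL-*ˡ vars y (λ i → A r i * x i))) ⟩
    sumL ys (λ (y , r) → y * dot (A r) x)
      ≤⟨ sumL-mono-∈ ys (λ (y , r) yr∈ → *-monoˡ-≤-0≤ (proj₁ (admissible D yr∈)) (feasible (proj₂ (admissible D yr∈)))) ⟩
    value D ∎
    where
    open ≤-Reasoning
    ys = multipliers D

  initial : List Combination
  initial = ((1ℚ , nothing) ∷ []) ∷ map (λ r → (1ℚ , just r) ∷ []) cons

  initial-admissible : ∀ {C} → C ∈ initial → Admissible C
  initial-admissible (here refl) (here refl) = 0≤1 , tt
  initial-admissible (there C∈) qk∈ with ∈-map⁻ (λ r → (1ℚ , just r) ∷ []) C∈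
  initial-admissible (there C∈) (here refl) | r , r∈ , refl = 0≤1 , r∈

  reduced : List Combination
  reduced = eliminateAll vars initial

  holds-single : {t : ℚ} {x : I → ℚ} (k : Maybe J) → Holds t x (combined ((1ℚ , k) ∷ [])) → Holds t x (row k)
  holds-single k = holds-resp {ι = combined ((1ℚ , k) ∷ [])} {row k} (unit _) (λ i → unit _) (unit _)
    where
    unit : ∀ a → 1ℚ * a + 0ℚ ≡ a
    unit a = trans (+-identityʳ _) (*-identityˡ a)

  holds-objective : {t : ℚ} {x : I → ℚ} → Holds t x (row nothing) → t ≤ objective x
  holds-objective {t} {x} holds = begin
    t                                              ≡⟨ identity t (objective x) ⟩
    (1ℚ * t - objective x) + objective x           ≡⟨ cong (λ d → (1ℚ * t + d) + objective x) (dot-neg c x) ⟨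
    (1ℚ * t + dot (λ i → - c i) x) + objective x   ≤⟨ +-monoˡ-≤ (objective x) holds ⟩
    0ℚ + objective x                               ≡⟨ +-identityˡ _ ⟩
    objective x                                    ∎
    where
    open ≤-Reasoning
    identity : ∀ t o → t ≡ (1ℚ * t - o) + o
    identity = solve-∀ ℚ-ring

  holds-objective⁻ : {t : ℚ} {x : I → ℚ} → t ≤ objective x → Holds t x (row nothing)
  holds-objective⁻ {t} {x} t≤ = begin
    1ℚ * t + dot (λ i → - c i) x     ≡⟨ cong₂ _+_ (*-identityˡ t) (dot-neg c x) ⟩
    t - objective x                  ≤⟨ +-monoˡ-≤ (- objective x) t≤ ⟩
    objective x - objective x        ≡⟨ +-inverseʳ (objective x) ⟩
    0ℚ                               ∎
    where open ≤-Reasoning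

  holds-constraint : {t : ℚ} {x : I → ℚ} (r : J) → Holds t x (row (just r)) → dot (A r) x ≤ b r
  holds-constraint {t} {x} r = subst (_≤ b r) (trans (cong (_+ dot (A r) x) (*-zeroˡ t)) (+-identityˡ _))

  holds-constraint⁻ : {t : ℚ} {x : I → ℚ} (r : J) → dot (A r) x ≤ b r → Holds t x (row (just r))
  holds-constraint⁻ {t} {x} r = subst (_≤ b r) (sym (trans (cong (_+ dot (A r) x) (*-zeroˡ t)) (+-identityˡ _)))

  lhs-reduced : {t : ℚ} {x : I → ℚ} {C : Combination} → C ∈ reduced →
    tcoeff (combined C) * t + dot (xcoeff (combined C)) x ≡ tcoeff (combined C) * t
  lhs-reduced {t} {x} {C} C∈ =
    trans (cong (tcoeff (combined C) * t +_) (dot-≡0 (xcoeff (combined C)) x (λ i i∈ → eliminateAll-zero i∈ C∈))) (+-identityʳ _)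

  feasible⇒reduced : {t : ℚ} {x : I → ℚ} → Feasible x → t ≤ objective x →
    ∀ {C} → C ∈ reduced → tcoeff (combined C) * t ≤ rhs (combined C)
  feasible⇒reduced {t} {x} feasible t≤ {C} C∈ =
    subst (_≤ _) (lhs-reduced C∈) (combined-holds rows-hold C (eliminateAll-admissible vars initial-admissible C∈))
    where
    rows-hold : ∀ k → InSystem k → Holds t x (row k)
    rows-hold nothing  _  = holds-objective⁻ t≤
    rows-hold (just r) r∈ = holds-constraint⁻ {t} {x} r (feasible r∈)

  reduced⇒feasible : {t : ℚ} → (∀ {C} → C ∈ reduced → tcoeff (combined C) * t ≤ rhs (combined C)) →
    Σ (I → ℚ) λ x → Feasible x × t ≤ objective x
  reduced⇒feasible {t} bounds =
    x , (λ {r} r∈ → holds-constraint {t} r (holds-single {t} {x} (just r) (holds (there (∈-map⁺ (λ r → (1ℚ , just r) ∷ []) r∈)))))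
      , holds-objective (holds-single {t} {x} nothing (holds (here refl)))
    where
    lifted = eliminateAll-lift vars (λ j∈ → j∈) initial {t} {λ _ → 0ℚ}
               (λ C∈ → subst (_≤ _) (sym (lhs-reduced C∈)) (bounds C∈))
    x = proj₁ lifted
    holds = proj₂ lifted

  constraintWeights : Combination → List (ℚ × J)
  constraintWeights []                  = []
  constraintWeights ((_ , nothing) ∷ C) = constraintWeights C
  constraintWeights ((q , just r) ∷ C)  = (q , r) ∷ constraintWeights C

  xcoeff-constraintWeights : (C : Combination) (i : I) →
    xcoeff (combined C) i + tcoeff (combined C) * c i ≡ weighted (λ r → A r i) (constraintWeights C)
  xcoeff-constraintWeights [] i = trans (+-identityˡ _) (*-zeroˡ (c i))
  xcoeff-constraintWeights ((q , nothing) ∷ C) i = trans (objective-row q (xcoeff (combined C) i) (tcoeff (combined C)) (c i)) (xcoeff-constraintWeights C i)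
    where
    objective-row : ∀ q a T c → (q * (- c) + a) + (q * 1ℚ + T) * c ≡ a + T * c
    objective-row = solve-∀ ℚ-ring
  xcoeff-constraintWeights ((q , just r) ∷ C) i =
    trans (constraint-row q (A r i) (xcoeff (combined C) i) (tcoeff (combined C)) (c i)) (cong (q * A r i +_) (xcoeff-constraintWeights C i))
    where
    constraint-row : ∀ q a a′ T c → (q * a + a′) + (q * 0ℚ + T) * c ≡ q * a + (a′ + T * c)
    constraint-row = solve-∀ ℚ-ring

  rhs-constraintWeights : (C : Combination) → rhs (combined C) ≡ weighted b (constraintWeights C)
  rhs-constraintWeights [] = refl
  rhs-constraintWeights ((q , nothing) ∷ C) = trans (cong (_+ rhs (combined C)) (*-zeroʳ q)) (trans (+-identityˡ _) (rhs-constraintWeights C))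
  rhs-constraintWeights ((q , just r) ∷ C)  = cong (q * b r +_) (rhs-constraintWeights C)

  constraintWeights-admissible : (C : Combination) → Admissible C → ∀ {y r} → (y , r) ∈ constraintWeights C → 0ℚ ≤ y × r ∈ cons
  constraintWeights-admissible ((q , nothing) ∷ C) adm yr∈           = constraintWeights-admissible C (adm ∘ there) yr∈
  constraintWeights-admissible ((q , just r) ∷ C)  adm (here refl)   = adm (here refl)
  constraintWeights-admissible ((q , just r) ∷ C)  adm (there yr∈)   = constraintWeights-admissible C (adm ∘ there) yr∈

  ratio : Combination → ℚ
  ratio C = rhs (combined C) * recip (tcoeff (combined C))

  -- A reduced inequality  τ t ≤ ρ  with τ > 0 is a nonnegative combination of the constraints
  -- plus τ times the objective row; dividing by τ gives a dual certificate of value ρ / τ.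
  certificate : {C : Combination} → C ∈ reduced → 0ℚ < tcoeff (combined C) →
    Σ DualCertificate λ D → value D ≡ ratio C
  certificate {C} C∈ 0<τ = D , value≡
    where
    τ = tcoeff (combined C)
    adm : ∀ {y r} → (y , r) ∈ scale (recip τ) (constraintWeights C) → 0ℚ ≤ y × r ∈ cons
    adm yr∈ with ∈-map⁻ (λ (q , r) → (recip τ * q , r)) yr∈
    ... | _ , qr∈ , refl with constraintWeights-admissible C (eliminateAll-admissible vars initial-admissible C∈) qr∈
    ...   | 0≤q , r∈ = *-nonNeg (<⇒≤ (recip-pos 0<τ)) 0≤q , r∈
    bal : ∀ {i} → i ∈ vars → weighted (λ r → A r i) (scale (recip τ) (constraintWeights C)) ≡ c i
    bal {i} i∈ = begin
      weighted (λ r → A r i) (scale (recip τ) (constraintWeights C))     ≡⟨ weighted-scale (λ r → A r i) (recip τ) (constraintWeights C) ⟩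
      recip τ * weighted (λ r → A r i) (constraintWeights C)             ≡⟨ cong (recip τ *_) (xcoeff-constraintWeights C i) ⟨
      recip τ * (xcoeff (combined C) i + τ * c i)            ≡⟨ cong (λ a → recip τ * (a + τ * c i)) (eliminateAll-zero i∈ C∈) ⟩
      recip τ * (0ℚ + τ * c i)                               ≡⟨ reorder (recip τ) τ (c i) ⟩
      τ * (c i * recip τ)                                    ≡⟨ *-*recip (>-≢0 0<τ) ⟩
      c i                                                    ∎
      where
      open ≡-Reasoning
      reorder : ∀ ρ τ c → ρ * (0ℚ + τ * c) ≡ τ * (c * ρ)
      reorder = solve-∀ ℚ-ring
    D : DualCertificate
    D = record { multipliers = scale (recip τ) (constraintWeights C) ; admissible = adm ; balanced = bal }
    value≡ : value D ≡ ratio C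
    value≡ = begin
      weighted b (scale (recip τ) (constraintWeights C))   ≡⟨ weighted-scale b (recip τ) (constraintWeights C) ⟩
      recip τ * weighted b (constraintWeights C)           ≡⟨ cong (recip τ *_) (rhs-constraintWeights C) ⟨
      recip τ * rhs (combined C)               ≡⟨ *-comm (recip τ) _ ⟩
      ratio C                                  ∎
      where open ≡-Reasoning

  unbounded : {x₀ : I → ℚ} → Feasible x₀ → (∀ {C} → C ∈ reduced → tcoeff (combined C) ≤ 0ℚ) →
    (t : ℚ) → Σ (I → ℚ) λ x → Feasible x × t ≤ objective x
  unbounded {x₀} feasible₀ nonpos t =
    let x , feasible , t′≤ = reduced⇒feasible bounds in x , feasible , ≤-trans (p≤p⊔q t _) t′≤
    where
    t′ = t ⊔ objective x₀
    bounds : ∀ {C} → C ∈ reduced → tcoeff (combined C) * t′ ≤ rhs (combined C)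
    bounds C∈ = ≤-trans (*-antimonoˡ-≤-≤0 (nonpos C∈) (p≤q⊔p t _)) (feasible⇒reduced feasible₀ ≤-refl C∈)

  attained : {x₀ : I → ℚ} → Feasible x₀ → {C* : Combination} → C* ∈ reduced → 0ℚ < tcoeff (combined C*) →
    (∀ {C} → C ∈ reduced → 0ℚ < tcoeff (combined C) → ratio C* ≤ ratio C) →
    Σ (I → ℚ) λ x → Feasible x × ratio C* ≤ objective x
  attained {x₀} feasible₀ {C*} C*∈ 0<τ* minimal = reduced⇒feasible bounds
    where
    t₀≤ : objective x₀ ≤ ratio C*
    t₀≤ = *≤⇒≤*recip 0<τ* (feasible⇒reduced feasible₀ ≤-refl C*∈)
    bounds : ∀ {C} → C ∈ reduced → tcoeff (combined C) * ratio C* ≤ rhs (combined C)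
    bounds {C} C∈ with 0ℚ <? tcoeff (combined C)
    ... | yes 0<τ = ≤*recip⇒*≤ 0<τ (minimal C∈ 0<τ)
    ... | no  τ≯0 = ≤-trans (*-antimonoˡ-≤-≤0 (≮⇒≥ τ≯0) t₀≤) (feasible⇒reduced feasible₀ ≤-refl C∈)

  strong-duality : {x₀ : I → ℚ} → Feasible x₀ → (B : ℚ) → (∀ {x} → Feasible x → objective x ≤ B) →
    Σ (I → ℚ) λ x → Feasible x × Σ DualCertificate λ D → value D ≤ objective x
  strong-duality {x₀} feasible₀ B bounded with any? (λ C → 0ℚ <? tcoeff (combined C)) reduced
  ... | no none =
    let x , feasible , B+1≤ = unbounded feasible₀ (λ C∈ → ≮⇒≥ (none ∘ lose C∈)) (B + 1ℚ)
    in ⊥-elim (<-irrefl refl (<-≤-trans (B<B+1) (≤-trans B+1≤ (bounded feasible))))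
    where
    B<B+1 : B < B + 1ℚ
    B<B+1 = ≤-<-trans (≤-reflexive (sym (+-identityʳ B))) (+-monoʳ-< B (positive⁻¹ 1ℚ))
  ... | yes some = x , feasible , D , subst (_≤ objective x) (sym value≡) ratio≤
    where
    C₀ = proj₁ (find some)
    positive-reduced = List.filter (λ C → 0ℚ <? tcoeff (combined C)) reduced
    C* = argmin ratio C₀ positive-reduced
    C*-props : C* ∈ reduced × 0ℚ < tcoeff (combined C*)
    C*-props = argmin-all ratio {xs = positive-reduced} (proj₂ (find some))
                 (All.tabulate (∈-filter⁻ (λ C → 0ℚ <? tcoeff (combined C)) {xs = reduced}))
    minimal : ∀ {C} → C ∈ reduced → 0ℚ < tcoeff (combined C) → ratio C* ≤ ratio C
    minimal C∈ 0<τ = All.lookup (f[argmin]≤f[xs] C₀ positive-reduced) (∈-filter⁺ (λ C → 0ℚ <? tcoeff (combined C)) C∈ 0<τ)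
    optimum = attained feasible₀ (proj₁ C*-props) (proj₂ C*-props) minimal
    x = proj₁ optimum
    feasible = proj₁ (proj₂ optimum)
    ratio≤ = proj₂ (proj₂ optimum)
    cert = certificate (proj₁ C*-props) (proj₂ C*-props)
    D = proj₁ cert
    value≡ = proj₂ cert

-- Probing orders

∈-filterB⁻ : (f : A → Bool) (xs : List A) {x : A} → x ∈ filterB f xs → x ∈ xs × f x ≡ true
∈-filterB⁻ f (y ∷ xs) x∈ with f y in fy
∈-filterB⁻ f (y ∷ xs) (here refl) | true  = here refl , fy
∈-filterB⁻ f (y ∷ xs) (there x∈)  | true  = let x∈xs , fx = ∈-filterB⁻ f xs x∈ in there x∈xs , fx
∈-filterB⁻ f (y ∷ xs) x∈          | false = let x∈xs , fx = ∈-filterB⁻ f xs x∈ in there x∈xs , fx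

∈-filterB⁺ : (f : A → Bool) {xs : List A} {x : A} → x ∈ xs → f x ≡ true → x ∈ filterB f xs
∈-filterB⁺ f {y ∷ xs} (here refl) fx rewrite fx = here refl
∈-filterB⁺ f {y ∷ xs} (there x∈) fx with f y
... | true  = there (∈-filterB⁺ f x∈ fx)
... | false = ∈-filterB⁺ f x∈ fx

notIn⇒All≢ : (u : Fin m) (l : List (Fin m)) → notIn u l ≡ true → All (u ≢_) l
notIn⇒All≢ u [] _ = []
notIn⇒All≢ u (u′ ∷ l) notIn≡ with u ≟ᶠ u′
notIn⇒All≢ u (u′ ∷ l) ()     | yes _
notIn⇒All≢ u (u′ ∷ l) notIn≡ | no u≢u′ = u≢u′ ∷ notIn⇒All≢ u l notIn≡

All≢⇒notIn : {u : Fin m} {l : List (Fin m)} → All (u ≢_) l → notIn u l ≡ true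
All≢⇒notIn [] = refl
All≢⇒notIn {u = u} {u′ ∷ l} (u≢u′ ∷ u≢l) with u ≟ᶠ u′
... | yes u≡u′ = ⊥-elim (u≢u′ u≡u′)
... | no _     = All≢⇒notIn u≢l

extensions : (m : ℕ) → List (Fin m) → List (List (Fin m))
extensions m l = map (_∷ l) (filterB (λ u → notIn u l) (allFin m))

∈-distinctUpTo⁻ : (k : ℕ) {e : List (Fin m)} → e ∈ distinctUpTo m k → Unique e
∈-distinctUpTo⁻ zero    (here refl) = []
∈-distinctUpTo⁻ (suc k) (here refl) = []
∈-distinctUpTo⁻ {m} (suc k) (there e∈) with find (∈-concatMap⁻ (extensions m) {xs = distinctUpTo m k} e∈)
... | l , l∈ , e∈ext with ∈-map⁻ (_∷ l) e∈ext
...   | u , u∈ , refl = notIn⇒All≢ u l (proj₂ (∈-filterB⁻ (λ u → notIn u l) (allFin m) u∈)) ∷ ∈-distinctUpTo⁻ k l∈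

∈-distinctUpTo⁺ : (k : ℕ) {e : List (Fin m)} → Unique e → length e ℕ.≤ k → e ∈ distinctUpTo m k
∈-distinctUpTo⁺ zero    {[]} _ _ = here refl
∈-distinctUpTo⁺ (suc k) {[]} _ _ = here refl
∈-distinctUpTo⁺ {m} (suc k) {u ∷ l} (u≢l ∷ unique) (s≤s len) =
  there (∈-concatMap⁺ (extensions m) {xs = distinctUpTo m k}
          (lose (∈-distinctUpTo⁺ k unique len) (∈-map⁺ (_∷ l) (∈-filterB⁺ (λ u → notIn u l) (∈-allFin u) (All≢⇒notIn u≢l)))))

isEmpty : List A → ℚ
isEmpty []      = 1ℚ
isEmpty (_ ∷ _) = 0ℚ

sum-isEmpty : (m k : ℕ) → sumL (distinctUpTo m k) isEmpty ≡ 1ℚ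
sum-isEmpty m zero    = refl
sum-isEmpty m (suc k) = trans (cong (1ℚ +_) (sumL-≡0 (concatMap (extensions m) (distinctUpTo m k)) nonempty)) (+-identityʳ 1ℚ)
  where
  nonempty : ∀ e → e ∈ concatMap (extensions m) (distinctUpTo m k) → isEmpty e ≡ 0ℚ
  nonempty e e∈ with find (∈-concatMap⁻ (extensions m) {xs = distinctUpTo m k} e∈)
  ... | l , _ , e∈ext with ∈-map⁻ (_∷ l) e∈ext
  ...   | u , _ , refl = refl

module _ {m n : ℕ} (G : StochGraph m n) where
  open StochGraph G

  p̄ : Fin m → Fin n → ℚ
  p̄ u v = 1ℚ - p u v

  0≤p̄ : ∀ u v → 0ℚ ≤ p̄ u v
  0≤p̄ u v = p≤q⇒0≤q-p (p-le-one u v)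

  p̄≤1 : ∀ u v → p̄ u v ≤ 1ℚ
  p̄≤1 u v = 0≤q-p⇒p≤q (subst (0ℚ ≤_) (identity (p u v)) (p-nonneg u v))
    where
    identity : ∀ p → p ≡ 1ℚ - (1ℚ - p)
    identity = solve-∀ ℚ-ring

  -- reachFrom u v c l is c · g(l_{<(u,v)}) if u occurs in l (the probability that probing l reaches u), else 0.
  reachFrom : Fin m → Fin n → ℚ → List (Fin m) → ℚ
  reachFrom u v c []       = 0ℚ
  reachFrom u v c (u′ ∷ l) = if does (u ≟ᶠ u′) then c else reachFrom u v (c * (1ℚ - p u′ v)) l

  coefFrom≡p*reachFrom : (u : Fin m) (v : Fin n) (c : ℚ) (l : List (Fin m)) →
    coefFrom G u v c l ≡ p u v * reachFrom u v c l
  coefFrom≡p*reachFrom u v c []       = sym (*-zeroʳ (p u v))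
  coefFrom≡p*reachFrom u v c (u′ ∷ l) with does (u ≟ᶠ u′)
  ... | true  = refl
  ... | false = coefFrom≡p*reachFrom u v (c * (1ℚ - p u′ v)) l

  reachFrom-nonNeg : (u : Fin m) (v : Fin n) {c : ℚ} (l : List (Fin m)) → 0ℚ ≤ c → 0ℚ ≤ reachFrom u v c l
  reachFrom-nonNeg u v []       0≤c = ≤-refl
  reachFrom-nonNeg u v (u′ ∷ l) 0≤c with does (u ≟ᶠ u′)
  ... | true  = 0≤c
  ... | false = reachFrom-nonNeg u v l (*-nonNeg 0≤c (0≤p̄ u′ v))

  coefFrom-here : (u : Fin m) (v : Fin n) (c : ℚ) (l : List (Fin m)) → coefFrom G u v c (u ∷ l) ≡ p u v * c
  coefFrom-here u v c l with u ≟ᶠ u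
  ... | yes _  = refl
  ... | no u≢u = ⊥-elim (u≢u refl)

  coefFrom-there : {u u′ : Fin m} (v : Fin n) (c : ℚ) (l : List (Fin m)) → u ≢ u′ →
    coefFrom G u v c (u′ ∷ l) ≡ coefFrom G u v (c * (1ℚ - p u′ v)) l
  coefFrom-there {u} {u′} v c l u≢u′ with u ≟ᶠ u′
  ... | yes u≡u′ = ⊥-elim (u≢u′ u≡u′)
  ... | no _     = refl

  coefFrom-∉ : {u : Fin m} (v : Fin n) (c : ℚ) {l : List (Fin m)} → All (u ≢_) l → coefFrom G u v c l ≡ 0ℚ
  coefFrom-∉ v c []                     = refl
  coefFrom-∉ v c {u′ ∷ l} (u≢u′ ∷ u∉l) = trans (coefFrom-there v c l u≢u′) (coefFrom-∉ v _ u∉l)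

  valueWith : (Fin m → ℚ) → Fin n → ℚ → List (Fin m) → ℚ
  valueWith d v c []      = 0ℚ
  valueWith d v c (u ∷ l) = p u v * d u * c + valueWith d v (c * (1ℚ - p u v)) l

  valFrom≡valueWith : (v : Fin n) (c : ℚ) (l : List (Fin m)) → valFrom G v c l ≡ valueWith (λ u → w u v) v c l
  valFrom≡valueWith v c []      = refl
  valFrom≡valueWith v c (u ∷ l) = cong (p u v * w u v * c +_) (valFrom≡valueWith v _ l)

  valueWith≡Σcoef : (d : Fin m → ℚ) (v : Fin n) (c : ℚ) {l : List (Fin m)} → Unique l →
    valueWith d v c l ≡ sumFin m (λ u → d u * coefFrom G u v c l)
  valueWith≡Σcoef d v c {[]} [] = sym (sumL-≡0 (allFin m) (λ u _ → *-zeroʳ (d u)))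
  valueWith≡Σcoef d v c {u′ ∷ l} (u′∉l ∷ unique) = begin
    p u′ v * d u′ * c + valueWith d v c′ l
      ≡⟨ cong₂ _+_ (reorder (p u′ v) (d u′) c) (valueWith≡Σcoef d v c′ unique) ⟩
    d u′ * (p u′ v * c) + sumFin m (λ u → d u * coefFrom G u v c′ l)
      ≡⟨ cong (_+ sumFin m (λ u → d u * coefFrom G u v c′ l)) (sumFin-δ m u′ (λ _ → d u′ * (p u′ v * c))) ⟨
    sumFin m (λ u → δ _≟ᶠ_ u u′ * (d u′ * (p u′ v * c))) + sumFin m (λ u → d u * coefFrom G u v c′ l)
      ≡⟨ sumL-+ (allFin m) (λ u → δ _≟ᶠ_ u u′ * (d u′ * (p u′ v * c))) (λ u → d u * coefFrom G u v c′ l) ⟨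
    sumFin m (λ u → δ _≟ᶠ_ u u′ * (d u′ * (p u′ v * c)) + d u * coefFrom G u v c′ l)
      ≡⟨ sumL-cong (allFin m) term ⟩
    sumFin m (λ u → d u * coefFrom G u v c (u′ ∷ l)) ∎
    where
    open ≡-Reasoning
    c′ = c * (1ℚ - p u′ v)
    X  = d u′ * (p u′ v * c)
    reorder : ∀ p d c → p * d * c ≡ d * (p * c)
    reorder = solve-∀ ℚ-ring
    term : ∀ u → δ _≟ᶠ_ u u′ * (d u′ * (p u′ v * c)) + d u * coefFrom G u v c′ l ≡ d u * coefFrom G u v c (u′ ∷ l)
    term u with u ≟ᶠ u′
    ... | yes refl = trans (cong₂ _+_ (*-identityˡ X) (trans (cong (d u *_) (coefFrom-∉ v c′ u′∉l)) (*-zeroʳ (d u)))) (+-identityʳ X)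
    ... | no _     = trans (cong (_+ d u * coefFrom G u v c′ l) (*-zeroˡ X)) (+-identityˡ _)

  valueWith-shift : (d : Fin m → ℚ) (k : ℚ) (v : Fin n) (c : ℚ) (l : List (Fin m)) →
    valueWith (λ u → d u - k) v c l ≡ valueWith d v c l - k * (c - c * g G v l)
  valueWith-shift d k v c [] = vanish k c
    where
    vanish : ∀ k c → 0ℚ ≡ 0ℚ - k * (c - c * 1ℚ)
    vanish = solve-∀ ℚ-ring
  valueWith-shift d k v c (u ∷ l) rewrite valueWith-shift d k v (c * (1ℚ - p u v)) l =
    telescope (p u v) (d u) k c (valueWith d v (c * (1ℚ - p u v)) l) (g G v l)
    where
    telescope : ∀ p d k c V g → p * (d - k) * c + (V - k * (c * (1ℚ - p) - c * (1ℚ - p) * g))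
                                ≡ p * d * c + V - k * (c - c * ((1ℚ - p) * g))
    telescope = solve-∀ ℚ-ring

  valueWith-snoc : (d : Fin m → ℚ) (v : Fin n) (c : ℚ) (l : List (Fin m)) (a : Fin m) →
    valueWith d v c (l ++ a ∷ []) ≡ valueWith d v c l + p a v * d a * (c * g G v l)
  valueWith-snoc d v c [] a = last (p a v) (d a) c
    where
    last : ∀ p d c → p * d * c + 0ℚ ≡ 0ℚ + p * d * (c * 1ℚ)
    last = solve-∀ ℚ-ring
  valueWith-snoc d v c (u ∷ l) a rewrite valueWith-snoc d v (c * (1ℚ - p u v)) l a =
    regroup (p u v * d u * c) (valueWith d v (c * (1ℚ - p u v)) l) (p a v * d a) c (p u v) (g G v l)
    where
    regroup : ∀ X V e c p g → X + (V + e * (c * (1ℚ - p) * g)) ≡ X + V + e * (c * ((1ℚ - p) * g))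
    regroup = solve-∀ ℚ-ring

  g-snoc : (v : Fin n) (l : List (Fin m)) (a : Fin m) → g G v (l ++ a ∷ []) ≡ g G v l * (1ℚ - p a v)
  g-snoc v []      a = trans (*-identityʳ (1ℚ - p a v)) (sym (*-identityˡ (1ℚ - p a v)))
  g-snoc v (u ∷ l) a rewrite g-snoc v l a = sym (*-assoc (1ℚ - p u v) (g G v l) (1ℚ - p a v))

  val≡Σcoef : (v : Fin n) {e : List (Fin m)} → e ∈ configs m → val G v e ≡ sumFin m (λ u → w u v * coef G u v e)
  val≡Σcoef v {e} e∈ = trans (valFrom≡valueWith v 1ℚ e) (valueWith≡Σcoef (λ u → w u v) v 1ℚ (∈-distinctUpTo⁻ m e∈))

  prodSub-p̄≤1 : (v : Fin n) (S : Subset m) → prodSub S (λ u → p̄ u v) ≤ 1ℚ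
  prodSub-p̄≤1 v S = proj₂ (prodSub-∈[0,1] S (λ u → p̄ u v) (λ u → 0≤p̄ u v) (λ u → p̄≤1 u v))

  sumSub-coefFrom≤ : (v : Fin n) {c : ℚ} {l : List (Fin m)} → Unique l → 0ℚ ≤ c → (S : Subset m) →
    sumSub S (λ u → coefFrom G u v c l) ≤ c * (1ℚ - prodSub S (λ u → p̄ u v))
  sumSub-coefFrom≤ v {c} {[]} [] 0≤c S =
    ≤-trans (≤-reflexive (sumSub-0 S)) (*-nonNeg 0≤c (p≤q⇒0≤q-p (prodSub-p̄≤1 v S)))
  sumSub-coefFrom≤ v {c} {u′ ∷ l} (u′∉l ∷ unique) 0≤c S with u′ ∈? S
  ... | yes u′∈S = begin
    sumSub S (λ u → coefFrom G u v c (u′ ∷ l))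
      ≡⟨ sumSub-split (λ u → coefFrom G u v c (u′ ∷ l)) u′∈S ⟩
    coefFrom G u′ v c (u′ ∷ l) + sumSub S′ (λ u → coefFrom G u v c (u′ ∷ l))
      ≡⟨ cong₂ _+_ (coefFrom-here u′ v c l) (sumSub-cong S′ (λ u u∈ → coefFrom-there v c l (≢u′ u∈))) ⟩
    p u′ v * c + sumSub S′ (λ u → coefFrom G u v c′ l)
      ≤⟨ +-monoʳ-≤ (p u′ v * c) (sumSub-coefFrom≤ v unique (*-nonNeg 0≤c (0≤p̄ u′ v)) S′) ⟩
    p u′ v * c + c′ * (1ℚ - prodSub S′ (λ u → p̄ u v))
      ≡⟨ telescope c (p u′ v) (prodSub S′ (λ u → p̄ u v)) ⟩
    c * (1ℚ - p̄ u′ v * prodSub S′ (λ u → p̄ u v))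
      ≡⟨ cong (λ P → c * (1ℚ - P)) (prodSub-split (λ u → p̄ u v) u′∈S) ⟨
    c * (1ℚ - prodSub S (λ u → p̄ u v)) ∎
    where
    open ≤-Reasoning
    S′ = S ∖ u′
    c′ = c * (1ℚ - p u′ v)
    ≢u′ : ∀ {u} → u ∈ˢ S′ → u ≢ u′
    ≢u′ u∈ refl = x∉p∖x S u′ u∈
    telescope : ∀ c p P → p * c + c * (1ℚ - p) * (1ℚ - P) ≡ c * (1ℚ - (1ℚ - p) * P)
    telescope = solve-∀ ℚ-ring
  ... | no u′∉S = begin
    sumSub S (λ u → coefFrom G u v c (u′ ∷ l))
      ≡⟨ sumSub-cong S (λ u u∈ → coefFrom-there v c l (λ { refl → u′∉S u∈ })) ⟩
    sumSub S (λ u → coefFrom G u v c′ l)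
      ≤⟨ sumSub-coefFrom≤ v unique (*-nonNeg 0≤c (0≤p̄ u′ v)) S ⟩
    c′ * (1ℚ - P)
      ≤⟨ 0≤q-p⇒p≤q (subst (0ℚ ≤_) (loss c (p u′ v) P) (*-nonNeg (*-nonNeg 0≤c (p-nonneg u′ v)) (p≤q⇒0≤q-p (prodSub-p̄≤1 v S)))) ⟩
    c * (1ℚ - P) ∎
    where
    open ≤-Reasoning
    c′ = c * (1ℚ - p u′ v)
    P  = prodSub S (λ u → p̄ u v)
    loss : ∀ c p P → c * p * (1ℚ - P) ≡ c * (1ℚ - P) - c * (1ℚ - p) * (1ℚ - P)
    loss = solve-∀ ℚ-ring

  sumSub-shift : (S : Subset m) {a : Fin m} (d z : Fin m → ℚ) → a ∈ˢ S →
    sumSub S (λ u → d u * z u) ≡ d a * sumSub S z + sumSub (S ∖ a) (λ u → (d u - d a) * z u)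
  sumSub-shift S {a} d z a∈S = begin
    sumSub S (λ u → d u * z u)
      ≡⟨ sumSub-split (λ u → d u * z u) a∈S ⟩
    d a * z a + sumSub S′ (λ u → d u * z u)
      ≡⟨ cong (d a * z a +_) (sumSub-cong S′ (λ u _ → split (d u) (d a) (z u))) ⟩
    d a * z a + sumSub S′ (λ u → (d u - d a) * z u + d a * z u)
      ≡⟨ cong (d a * z a +_) (sumSub-+ S′ (λ u → (d u - d a) * z u) (λ u → d a * z u)) ⟩
    d a * z a + (sumSub S′ (λ u → (d u - d a) * z u) + sumSub S′ (λ u → d a * z u))
      ≡⟨ cong (λ Z → d a * z a + (sumSub S′ (λ u → (d u - d a) * z u) + Z)) (sumSub-*ˡ S′ (d a) z) ⟩
    d a * z a + (sumSub S′ (λ u → (d u - d a) * z u) + d a * sumSub S′ z)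
      ≡⟨ regroup (d a) (z a) (sumSub S′ (λ u → (d u - d a) * z u)) (sumSub S′ z) ⟩
    d a * (z a + sumSub S′ z) + sumSub S′ (λ u → (d u - d a) * z u)
      ≡⟨ cong (λ Z → d a * Z + sumSub S′ (λ u → (d u - d a) * z u)) (sumSub-split z a∈S) ⟨
    d a * sumSub S z + sumSub S′ (λ u → (d u - d a) * z u) ∎
    where
    open ≡-Reasoning
    S′ = S ∖ a
    split : ∀ d e z → d * z ≡ (d - e) * z + e * z
    split = solve-∀ ℚ-ring
    regroup : ∀ e za D Z → e * za + (D + e * Z) ≡ e * (za + Z) + D
    regroup = solve-∀ ℚ-ring

  -- Greedy probing in order of decreasing reward: an LP-QC point at v is dominated by one probing order.
  module Greedy (v : Fin n) (z : Fin m → ℚ) (qc : ∀ S → sumSub S z ≤ 1ℚ - prodSub S (λ u → p̄ u v)) where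

    record Order (k : ℕ) (S : Subset m) (d : Fin m → ℚ) : Set where
      field
        order     : List (Fin m)
        unique    : Unique order
        short     : length order ℕ.≤ k
        ⊆S        : ∀ {u} → u ∈ order → u ∈ˢ S
        survival  : g G v order ≡ prodSub S (λ u → p̄ u v)
        dominates : sumSub S (λ u → d u * z u) ≤ valueWith d v 1ℚ order

    emptyOrder : (k : ℕ) (d : Fin m → ℚ) → Order k ⊥ d
    emptyOrder k d = record
      { order     = []
      ; unique    = []
      ; short     = z≤n
      ; ⊆S        = λ ()
      ; survival  = sym (prodSub-⊥ (λ u → p̄ u v))
      ; dominates = ≤-reflexive (sumSub-⊥ (λ u → d u * z u))
      }

    -- Probe the element a of least reward last: the rewards d - d a on S ∖ a are handled recursively,
    -- and the constant reward d a on all of S is covered by the LP-QC constraint of S.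
    snoc-dominates : (S : Subset m) (d : Fin m → ℚ) {a : Fin m} → a ∈ˢ S → 0ℚ ≤ d a →
      (order : List (Fin m)) → g G v order ≡ prodSub (S ∖ a) (λ u → p̄ u v) →
      sumSub (S ∖ a) (λ u → (d u - d a) * z u) ≤ valueWith (λ u → d u - d a) v 1ℚ order →
      sumSub S (λ u → d u * z u) ≤ valueWith d v 1ℚ (order ++ a ∷ [])
    snoc-dominates S d {a} a∈S 0≤da order survival dominates = begin
      sumSub S (λ u → d u * z u)                                      ≡⟨ sumSub-shift S d z a∈S ⟩
      d a * sumSub S z + sumSub (S ∖ a) (λ u → (d u - d a) * z u)     ≤⟨ +-mono-≤ (*-monoˡ-≤-0≤ 0≤da (qc S)) dominates ⟩
      d a * (1ℚ - prodSub S (λ u → p̄ u v)) + valueWith (λ u → d u - d a) v 1ℚ order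
        ≡⟨ cong₂ (λ P V → d a * (1ℚ - P) + V) (prodSub-split (λ u → p̄ u v) a∈S) (valueWith-shift d (d a) v 1ℚ order) ⟩
      d a * (1ℚ - p̄ a v * P′) + (V - d a * (1ℚ - 1ℚ * g G v order))
        ≡⟨ cong (λ Γ → d a * (1ℚ - p̄ a v * P′) + (V - d a * (1ℚ - 1ℚ * Γ))) survival ⟩
      d a * (1ℚ - p̄ a v * P′) + (V - d a * (1ℚ - 1ℚ * P′))           ≡⟨ telescope (d a) (p a v) P′ V ⟩
      V + p a v * d a * (1ℚ * P′)                                     ≡⟨ cong (λ Γ → V + p a v * d a * (1ℚ * Γ)) survival ⟨
      V + p a v * d a * (1ℚ * g G v order)                            ≡⟨ valueWith-snoc d v 1ℚ order a ⟨
      valueWith d v 1ℚ (order ++ a ∷ [])                              ∎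
      where
      open ≤-Reasoning
      P′ = prodSub (S ∖ a) (λ u → p̄ u v)
      V  = valueWith d v 1ℚ order
      telescope : ∀ e p P V → e * (1ℚ - (1ℚ - p) * P) + (V - e * (1ℚ - 1ℚ * P)) ≡ V + p * e * (1ℚ * P)
      telescope = solve-∀ ℚ-ring

    snocOrder : (k : ℕ) (S : Subset m) (d : Fin m → ℚ) {a : Fin m} → a ∈ˢ S → 0ℚ ≤ d a →
      Order k (S ∖ a) (λ u → d u - d a) → Order (suc k) S d
    snocOrder k S d {a} a∈S 0≤da rest = record
      { order     = order ++ a ∷ []
      ; unique    = Unique.++⁺ unique ([] ∷ []) (λ { (a∈ , here refl) → x∉p∖x S a (⊆S a∈) })
      ; short     = subst (ℕ._≤ suc k) (trans (ℕ.+-comm 1 (length order)) (sym (Listₚ.length-++ order))) (s≤s short)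
      ; ⊆S        = λ u∈ → from-parts (∈-++⁻ order u∈)
      ; survival  = survival′
      ; dominates = snoc-dominates S d a∈S 0≤da order survival dominates
      }
      where
      open Order rest
      from-parts : ∀ {u} → u ∈ order ⊎ u ∈ a ∷ [] → u ∈ˢ S
      from-parts (inj₁ u∈)          = p─q⊆p S _ (⊆S u∈)
      from-parts (inj₂ (here refl)) = a∈S
      survival′ : g G v (order ++ a ∷ []) ≡ prodSub S (λ u → p̄ u v)
      survival′ = begin
        g G v (order ++ a ∷ [])                   ≡⟨ g-snoc v order a ⟩
        g G v order * p̄ a v                       ≡⟨ cong (_* p̄ a v) survival ⟩
        prodSub (S ∖ a) (λ u → p̄ u v) * p̄ a v     ≡⟨ *-comm _ (p̄ a v) ⟩
        p̄ a v * prodSub (S ∖ a) (λ u → p̄ u v)     ≡⟨ prodSub-split (λ u → p̄ u v) a∈S ⟨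
        prodSub S (λ u → p̄ u v)                   ∎
        where open ≡-Reasoning

    greedy : (k : ℕ) (S : Subset m) → ∣ S ∣ ℕ.≤ k → (d : Fin m → ℚ) → (∀ {u} → u ∈ˢ S → 0ℚ ≤ d u) → Order k S d
    greedy k S size d 0≤d with nonempty? S
    ... | no empty rewrite Empty-unique empty = emptyOrder k d
    greedy zero S size d 0≤d | yes (a , a∈S) = ⊥-elim (ℕ.<-irrefl refl (ℕ.<-≤-trans (x∈p⇒∣p-x∣<∣p∣ a∈S) (ℕ.≤-trans size z≤n)))
    greedy (suc k) S size d 0≤d | yes (a₀ , a₀∈S) =
      snocOrder k S d a∈S (0≤d a∈S) (greedy k (S ∖ a) size′ (λ u → d u - d a) (λ u∈ → p≤q⇒0≤q-p (minimal _ (p─q⊆p S _ u∈))))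
      where
      a = proj₁ (argminSub S d a₀∈S)
      a∈S = proj₁ (proj₂ (argminSub S d a₀∈S))
      minimal = proj₂ (proj₂ (argminSub S d a₀∈S))
      size′ : ∣ S ∖ a ∣ ℕ.≤ k
      size′ = ℕ.≤-pred (ℕ.≤-trans (x∈p⇒∣p-x∣<∣p∣ a∈S) size)

  marginals : ConfigSol G → QCSol G
  marginals x u v = sumL (configs m) (λ e → reachFrom u v 1ℚ e * x v e)

  p*marginals : (x : ConfigSol G) (u : Fin m) (v : Fin n) →
    p u v * marginals x u v ≡ sumL (configs m) (λ e → coef G u v e * x v e)
  p*marginals x u v = begin
    p u v * sumL (configs m) (λ e → reachFrom u v 1ℚ e * x v e)     ≡⟨ sumL-*ˡ (configs m) (p u v) (λ e → reachFrom u v 1ℚ e * x v e) ⟨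
    sumL (configs m) (λ e → p u v * (reachFrom u v 1ℚ e * x v e))   ≡⟨ sumL-cong (configs m) (λ e → sym (*-assoc (p u v) _ (x v e))) ⟩
    sumL (configs m) (λ e → p u v * reachFrom u v 1ℚ e * x v e)     ≡⟨ sumL-cong (configs m) (λ e → cong (_* x v e) (coefFrom≡p*reachFrom u v 1ℚ e)) ⟨
    sumL (configs m) (λ e → coef G u v e * x v e)                   ∎
    where open ≡-Reasoning

  marginals-qc : (x : ConfigSol G) → ConfigFeasible G x → (v : Fin n) (S : Subset m) →
    sumSub S (λ u → p u v * marginals x u v) ≤ 1ℚ - prodSub S (λ u → p̄ u v)
  marginals-qc x (x≥0 , _ , sum≡1) v S = begin
    sumSub S (λ u → p u v * marginals x u v)
      ≡⟨ sumSub-cong S (λ u _ → p*marginals x u v) ⟩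
    sumSub S (λ u → sumL (configs m) (λ e → coef G u v e * x v e))
      ≡⟨ sumSub-swap S (configs m) (λ u e → coef G u v e * x v e) ⟩
    sumL (configs m) (λ e → sumSub S (λ u → coef G u v e * x v e))
      ≡⟨ sumL-cong (configs m) (λ e → trans (sumSub-cong S (λ u _ → *-comm _ (x v e))) (sumSub-*ˡ S (x v e) (λ u → coef G u v e))) ⟩
    sumL (configs m) (λ e → x v e * sumSub S (λ u → coef G u v e))
      ≤⟨ sumL-mono-∈ (configs m) (λ e e∈ → *-monoˡ-≤-0≤ (x≥0 v e e∈) (sumSub-coefFrom≤ v (∈-distinctUpTo⁻ m e∈) 0≤1 S)) ⟩
    sumL (configs m) (λ e → x v e * (1ℚ * (1ℚ - P)))
      ≡⟨ sumL-*ʳ (configs m) (1ℚ * (1ℚ - P)) (x v) ⟩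
    sumL (configs m) (x v) * (1ℚ * (1ℚ - P))
      ≡⟨ cong (_* (1ℚ * (1ℚ - P))) (sum≡1 v) ⟩
    1ℚ * (1ℚ * (1ℚ - P))
      ≡⟨ trans (*-identityˡ _) (*-identityˡ _) ⟩
    1ℚ - P ∎
    where
    open ≤-Reasoning
    P = prodSub S (λ u → p̄ u v)

  marginals-feasible : (x : ConfigSol G) → ConfigFeasible G x → QCFeasible G (marginals x)
  marginals-feasible x feasible@(x≥0 , capacity , _) =
    (λ u v → sumL-nonNeg (configs m) (λ e e∈ → *-nonNeg (reachFrom-nonNeg u v e 0≤1) (x≥0 v e e∈)))
    , marginals-qc x feasible
    , λ u → subst (_≤ 1ℚ) (sumL-cong (allFin n) (λ v → sym (p*marginals x u v))) (capacity u)

  marginals-objective : (x : ConfigSol G) → qcObj G (marginals x) ≡ configObj G x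
  marginals-objective x = begin
    sumFin m (λ u → sumFin n (λ v → w u v * p u v * marginals x u v))
      ≡⟨ sumL-cong (allFin m) (λ u → sumL-cong (allFin n) (λ v → edge u v)) ⟩
    sumFin m (λ u → sumFin n (λ v → sumL (configs m) (λ e → w u v * coef G u v e * x v e)))
      ≡⟨ sumL-swap (allFin m) (allFin n) (λ u v → sumL (configs m) (λ e → w u v * coef G u v e * x v e)) ⟩
    sumFin n (λ v → sumFin m (λ u → sumL (configs m) (λ e → w u v * coef G u v e * x v e)))
      ≡⟨ sumL-cong (allFin n) (λ v → sumL-swap (allFin m) (configs m) (λ u e → w u v * coef G u v e * x v e)) ⟩
    sumFin n (λ v → sumL (configs m) (λ e → sumFin m (λ u → w u v * coef G u v e * x v e)))
      ≡⟨ sumL-cong (allFin n) (λ v → sumL-cong-∈ (configs m) (λ e e∈ → config v e e∈)) ⟩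
    configObj G x ∎
    where
    open ≡-Reasoning
    edge : ∀ u v → w u v * p u v * marginals x u v ≡ sumL (configs m) (λ e → w u v * coef G u v e * x v e)
    edge u v = begin
      w u v * p u v * marginals x u v                               ≡⟨ *-assoc (w u v) (p u v) _ ⟩
      w u v * (p u v * marginals x u v)                             ≡⟨ cong (w u v *_) (p*marginals x u v) ⟩
      w u v * sumL (configs m) (λ e → coef G u v e * x v e)         ≡⟨ sumL-*ˡ (configs m) (w u v) (λ e → coef G u v e * x v e) ⟨
      sumL (configs m) (λ e → w u v * (coef G u v e * x v e))       ≡⟨ sumL-cong (configs m) (λ e → sym (*-assoc (w u v) _ (x v e))) ⟩
      sumL (configs m) (λ e → w u v * coef G u v e * x v e)         ∎
    config : ∀ v e → e ∈ configs m → sumFin m (λ u → w u v * coef G u v e * x v e) ≡ val G v e * x v e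
    config v e e∈ = trans (sumL-*ʳ (allFin m) (x v e) (λ u → w u v * coef G u v e)) (cong (_* x v e) (sym (val≡Σcoef v e∈)))

module ConfigLP {m n : ℕ} (G : StochGraph m n) where
  open StochGraph G

  Var : Set
  Var = Fin n × List (Fin m)

  _≟ᵛ_ : DecidableEquality Var
  _≟ᵛ_ = Productₚ.≡-dec _≟ᶠ_ (Listₚ.≡-dec _≟ᶠ_)

  vars : List Var
  vars = concatMap (λ v → map (v ,_) (configs m)) (allFin n)

  data Constraint : Set where
    nonnegativity   : Var → Constraint
    capacity : Fin m → Constraint
    atMostOne   : Fin n → Constraint
    atLeastOne  : Fin n → Constraint

  constraints : List Constraint
  constraints = map nonnegativity vars ++ map capacity (allFin m) ++ map atMostOne (allFin n) ++ map atLeastOne (allFin n)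

  a : Constraint → Var → ℚ
  a (nonnegativity j)    i       = - δ _≟ᵛ_ i j
  a (capacity u)  (v , e) = coef G u v e
  a (atMostOne v′)   (v , e) = δ _≟ᶠ_ v v′
  a (atLeastOne v′)  (v , e) = - δ _≟ᶠ_ v v′

  b : Constraint → ℚ
  b (nonnegativity _)   = 0ℚ
  b (capacity _) = 1ℚ
  b (atMostOne _)   = 1ℚ
  b (atLeastOne _)  = - 1ℚ

  c : Var → ℚ
  c (v , e) = val G v e

  open LinearProgram _≟ᵛ_ vars constraints a b c public

  ∈-vars⁻ : {v : Fin n} {e : List (Fin m)} → (v , e) ∈ vars → e ∈ configs m
  ∈-vars⁻ ve∈ with find (∈-concatMap⁻ (λ v → map (v ,_) (configs m)) {xs = allFin n} ve∈)
  ... | v , _ , ve∈v with ∈-map⁻ (v ,_) ve∈v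
  ...   | e , e∈ , refl = e∈

  ∈-vars⁺ : (v : Fin n) {e : List (Fin m)} → e ∈ configs m → (v , e) ∈ vars
  ∈-vars⁺ v e∈ = ∈-concatMap⁺ (λ v → map (v ,_) (configs m)) (lose (∈-allFin v) (∈-map⁺ (v ,_) e∈))

  nonnegativity∈ : {i : Var} → i ∈ vars → nonnegativity i ∈ constraints
  nonnegativity∈ i∈ = ∈-++⁺ˡ (∈-map⁺ nonnegativity i∈)

  capacity∈ : (u : Fin m) → capacity u ∈ constraints
  capacity∈ u = ∈-++⁺ʳ (map nonnegativity vars) (∈-++⁺ˡ (∈-map⁺ capacity (∈-allFin u)))

  atMostOne∈ : (v : Fin n) → atMostOne v ∈ constraints
  atMostOne∈ v = ∈-++⁺ʳ (map nonnegativity vars) (∈-++⁺ʳ (map capacity (allFin m)) (∈-++⁺ˡ (∈-map⁺ atMostOne (∈-allFin v))))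

  atLeastOne∈ : (v : Fin n) → atLeastOne v ∈ constraints
  atLeastOne∈ v = ∈-++⁺ʳ (map nonnegativity vars) (∈-++⁺ʳ (map capacity (allFin m)) (∈-++⁺ʳ (map atMostOne (allFin n)) (∈-map⁺ atLeastOne (∈-allFin v))))

  dot-nested : (a x : Var → ℚ) → dot a x ≡ sumFin n (λ v → sumL (configs m) (λ e → a (v , e) * x (v , e)))
  dot-nested a x = trans (sumL-concatMap (λ v → map (v ,_) (configs m)) (allFin n) (λ i → a i * x i))
                         (sumL-cong (allFin n) (λ v → sumL-map (v ,_) (configs m) (λ i → a i * x i)))

  dot-atMostOne : (x : Var → ℚ) (v′ : Fin n) → dot (a (atMostOne v′)) x ≡ sumL (configs m) (λ e → x (v′ , e))
  dot-atMostOne x v′ = begin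
    dot (a (atMostOne v′)) x
      ≡⟨ dot-nested (a (atMostOne v′)) x ⟩
    sumFin n (λ v → sumL (configs m) (λ e → δ _≟ᶠ_ v v′ * x (v , e)))
      ≡⟨ sumL-cong (allFin n) (λ v → sumL-*ˡ (configs m) (δ _≟ᶠ_ v v′) (λ e → x (v , e))) ⟩
    sumFin n (λ v → δ _≟ᶠ_ v v′ * sumL (configs m) (λ e → x (v , e)))
      ≡⟨ sumFin-δ n v′ (λ v → sumL (configs m) (λ e → x (v , e))) ⟩
    sumL (configs m) (λ e → x (v′ , e)) ∎
    where open ≡-Reasoning

  dot-atLeastOne : (x : Var → ℚ) (v′ : Fin n) → dot (a (atLeastOne v′)) x ≡ - sumL (configs m) (λ e → x (v′ , e))
  dot-atLeastOne x v′ = trans (dot-neg (a (atMostOne v′)) x) (cong -_ (dot-atMostOne x v′))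

  configObj≡objective : (x : ConfigSol G) → configObj G x ≡ objective (uncurry′ x)
  configObj≡objective x = sym (dot-nested c (uncurry′ x))

  feasible⇒configFeasible : {x : Var → ℚ} → Feasible x → ConfigFeasible G (curry′ x)
  feasible⇒configFeasible {x} feasible = x≥0 , capacity′ , sum≡1
    where
    x≥0 : ∀ v e → e ∈ configs m → 0ℚ ≤ x (v , e)
    x≥0 v e e∈ = *-cancelˡ-≤-0< (multiplicity-pos ve∈) (begin
      multiplicity (v , e) * 0ℚ            ≡⟨ *-zeroʳ (multiplicity (v , e)) ⟩
      0ℚ                                   ≤⟨ neg-antimono-≤ nonneg-row ⟩
      - - dot (λ i → δ _≟ᵛ_ i (v , e)) x   ≡⟨ neg-involutive _ ⟩
      dot (λ i → δ _≟ᵛ_ i (v , e)) x       ≡⟨ dot-δ (v , e) x ⟩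
      multiplicity (v , e) * x (v , e)     ∎)
      where
      open ≤-Reasoning
      ve∈ = ∈-vars⁺ v e∈
      nonneg-row : - dot (λ i → δ _≟ᵛ_ i (v , e)) x ≤ 0ℚ
      nonneg-row = subst (_≤ 0ℚ) (dot-neg (λ i → δ _≟ᵛ_ i (v , e)) x) (feasible (nonnegativity∈ ve∈))
    capacity′ : ∀ u → sumFin n (λ v → sumL (configs m) (λ e → coef G u v e * x (v , e))) ≤ 1ℚ
    capacity′ u = subst (_≤ 1ℚ) (dot-nested (a (capacity u)) x) (feasible (capacity∈ u))
    sum≡1 : ∀ v → sumL (configs m) (λ e → x (v , e)) ≡ 1ℚ
    sum≡1 v = ≤-antisym (subst (_≤ 1ℚ) (dot-atMostOne x v) (feasible (atMostOne∈ v)))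
      (subst₂ _≤_ (neg-involutive 1ℚ) (neg-involutive _)
        (neg-antimono-≤ (subst (_≤ - 1ℚ) (dot-atLeastOne x v) (feasible (atLeastOne∈ v)))))

  configFeasible⇒feasible : {x : ConfigSol G} → ConfigFeasible G x → Feasible (uncurry′ x)
  configFeasible⇒feasible {x} (x≥0 , capacity′ , sum≡1) {nonnegativity j} _ = begin
    dot (λ i → - δ _≟ᵛ_ i j) (uncurry′ x)
      ≡⟨ dot-neg (λ i → δ _≟ᵛ_ i j) (uncurry′ x) ⟩
    - dot (λ i → δ _≟ᵛ_ i j) (uncurry′ x)
      ≤⟨ neg-antimono-≤ (sumL-nonNeg vars (λ (v , e) ve∈ → *-nonNeg (δ-nonNeg _≟ᵛ_ (v , e) j) (x≥0 v e (∈-vars⁻ ve∈)))) ⟩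
    - 0ℚ ∎
    where open ≤-Reasoning
  configFeasible⇒feasible {x} (_ , capacity′ , _) {capacity u} _ = subst (_≤ 1ℚ) (sym (dot-nested (a (capacity u)) (uncurry′ x))) (capacity′ u)
  configFeasible⇒feasible {x} (_ , _ , sum≡1) {atMostOne v} _ = ≤-reflexive (trans (dot-atMostOne (uncurry′ x) v) (sum≡1 v))
  configFeasible⇒feasible {x} (_ , _ , sum≡1) {atLeastOne v} _ = ≤-reflexive (trans (dot-atLeastOne (uncurry′ x) v) (cong -_ (sum≡1 v)))

  emptyConfig : ConfigSol G
  emptyConfig v e = isEmpty e

  emptyConfig-feasible : ConfigFeasible G emptyConfig
  emptyConfig-feasible = (λ v e _ → isEmpty-nonNeg e) , (λ u → ≤-trans (≤-reflexive (load≡0 u)) 0≤1) , (λ v → sum-isEmpty m m)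
    where
    isEmpty-nonNeg : (e : List (Fin m)) → 0ℚ ≤ isEmpty e
    isEmpty-nonNeg []      = 0≤1
    isEmpty-nonNeg (_ ∷ _) = ≤-refl
    vanish : ∀ u v e → coef G u v e * isEmpty e ≡ 0ℚ
    vanish u v []      = *-zeroˡ 1ℚ
    vanish u v e@(_ ∷ _) = *-zeroʳ (coef G u v e)
    load≡0 : ∀ u → sumFin n (λ v → sumL (configs m) (λ e → coef G u v e * isEmpty e)) ≡ 0ℚ
    load≡0 u = sumL-≡0 (allFin n) (λ v _ → sumL-≡0 (configs m) (λ e _ → vanish u v e))

  maxVal : Fin n → ℚ
  maxVal v = max 0ℚ (map (val G v) (configs m))

  configObj-bounded : (x : ConfigSol G) → ConfigFeasible G x → configObj G x ≤ sumFin n maxVal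
  configObj-bounded x (x≥0 , _ , sum≡1) = sumL-mono (allFin n) (λ v → begin
    sumL (configs m) (λ e → val G v e * x v e)     ≤⟨ sumL-mono-∈ (configs m) (λ e e∈ → *-monoʳ-≤-0≤ (x≥0 v e e∈) (val≤max v e∈)) ⟩
    sumL (configs m) (λ e → maxVal v * x v e)      ≡⟨ sumL-*ˡ (configs m) (maxVal v) (x v) ⟩
    maxVal v * sumL (configs m) (x v)              ≡⟨ cong (maxVal v *_) (sum≡1 v) ⟩
    maxVal v * 1ℚ                                  ≡⟨ *-identityʳ (maxVal v) ⟩
    maxVal v                                       ∎)
    where
    open ≤-Reasoning
    val≤max : ∀ v {e} → e ∈ configs m → val G v e ≤ maxVal v
    val≤max v e∈ = All.lookup (xs≤max 0ℚ (map (val G v) (configs m))) (∈-map⁺ (val G v) e∈)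

  optimum : Σ (Var → ℚ) λ x → Feasible x × Σ DualCertificate λ D → value D ≤ objective x
  optimum = strong-duality (configFeasible⇒feasible emptyConfig-feasible) (sumFin n maxVal)
    (λ {x} feasible → subst (_≤ sumFin n maxVal) (configObj≡objective (curry′ x)) (configObj-bounded (curry′ x) (feasible⇒configFeasible feasible)))

  onCapacity : Fin m → Constraint → ℚ
  onCapacity u (capacity u′) = δ _≟ᶠ_ u u′
  onCapacity u _             = 0ℚ

  onVertex : Fin n → Constraint → ℚ
  onVertex v (atMostOne v′)  = δ _≟ᶠ_ v v′
  onVertex v (atLeastOne v′) = - δ _≟ᶠ_ v v′
  onVertex v _               = 0ℚ

  onCapacity-nonNeg : (u : Fin m) (r : Constraint) → 0ℚ ≤ onCapacity u r
  onCapacity-nonNeg u (nonnegativity _) = ≤-refl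
  onCapacity-nonNeg u (capacity u′)     = δ-nonNeg _≟ᶠ_ u u′
  onCapacity-nonNeg u (atMostOne _)     = ≤-refl
  onCapacity-nonNeg u (atLeastOne _)    = ≤-refl

  b-split : (r : Constraint) → b r ≡ sumFin m (λ u → onCapacity u r) + sumFin n (λ v → onVertex v r)
  b-split (nonnegativity _) = sym (trans (cong₂ _+_ (sumL-0 (allFin m)) (sumL-0 (allFin n))) (+-identityˡ 0ℚ))
  b-split (capacity u′)     = sym (trans (cong₂ _+_ (sumFin-δ-1 m u′) (sumL-0 (allFin n))) (+-identityʳ 1ℚ))
  b-split (atMostOne v′)    = sym (trans (cong₂ _+_ (sumL-0 (allFin m)) (sumFin-δ-1 n v′)) (+-identityˡ 1ℚ))
  b-split (atLeastOne v′)   = sym (trans (cong₂ _+_ (sumL-0 (allFin m)) (trans (sumL-neg (allFin n) (λ v → δ _≟ᶠ_ v v′)) (cong -_ (sumFin-δ-1 n v′))))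
                                         (+-identityˡ (- 1ℚ)))

  a≤split : (r : Constraint) (v : Fin n) (e : List (Fin m)) →
    a r (v , e) ≤ sumFin m (λ u → onCapacity u r * coef G u v e) + onVertex v r
  a≤split (nonnegativity j) v e = ≤-trans (neg-antimono-≤ (δ-nonNeg _≟ᵛ_ (v , e) j)) (≤-reflexive (sym (unconstrained 0ℚ)))
    where
    unconstrained : ∀ s → sumFin m (λ u → 0ℚ * coef G u v e) + s ≡ s
    unconstrained s = trans (cong (_+ s) (sumL-≡0 (allFin m) (λ u _ → *-zeroˡ (coef G u v e)))) (+-identityˡ s)
  a≤split (capacity u′) v e = ≤-reflexive (sym (trans (+-identityʳ _) (sumFin-δ m u′ (λ u → coef G u v e))))
  a≤split (atMostOne v′) v e =
    ≤-reflexive (sym (trans (cong (_+ δ _≟ᶠ_ v v′) (sumL-≡0 (allFin m) (λ u _ → *-zeroˡ (coef G u v e)))) (+-identityˡ _)))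
  a≤split (atLeastOne v′) v e =
    ≤-reflexive (sym (trans (cong (_+ - δ _≟ᶠ_ v v′) (sumL-≡0 (allFin m) (λ u _ → *-zeroˡ (coef G u v e)))) (+-identityˡ _)))

  module Dual (D : DualCertificate) where

    0≤multiplier : ∀ {q r} → (q , r) ∈ multipliers D → 0ℚ ≤ q
    0≤multiplier qr∈ = proj₁ (admissible D qr∈)

    α : Fin m → ℚ
    α u = weighted (onCapacity u) (multipliers D)

    β : Fin n → ℚ
    β v = weighted (onVertex v) (multipliers D)

    value-split : value D ≡ sumFin m α + sumFin n β
    value-split = begin
      weighted b (multipliers D)
        ≡⟨ sumL-cong (multipliers D) (λ (q , r) → cong (q *_) (b-split r)) ⟩
      weighted (λ r → sumFin m (λ u → onCapacity u r) + sumFin n (λ v → onVertex v r)) (multipliers D)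
        ≡⟨ weighted-+ (λ r → sumFin m (λ u → onCapacity u r)) (λ r → sumFin n (λ v → onVertex v r)) (multipliers D) ⟩
      weighted (λ r → sumFin m (λ u → onCapacity u r)) (multipliers D) + weighted (λ r → sumFin n (λ v → onVertex v r)) (multipliers D)
        ≡⟨ cong₂ _+_ (weighted-sumL (allFin m) onCapacity (multipliers D)) (weighted-sumL (allFin n) onVertex (multipliers D)) ⟩
      sumFin m α + sumFin n β ∎
      where open ≡-Reasoning

    dual-feasible : (v : Fin n) {e : List (Fin m)} → e ∈ configs m → val G v e ≤ sumFin m (λ u → α u * coef G u v e) + β v
    dual-feasible v {e} e∈ = begin
      val G v e
        ≡⟨ balanced D (∈-vars⁺ v e∈) ⟨
      weighted (λ r → a r (v , e)) (multipliers D)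
        ≤⟨ weighted-mono (multipliers D) 0≤multiplier (λ r → a≤split r v e) ⟩
      weighted (λ r → sumFin m (λ u → onCapacity u r * coef G u v e) + onVertex v r) (multipliers D)
        ≡⟨ weighted-+ (λ r → sumFin m (λ u → onCapacity u r * coef G u v e)) (onVertex v) (multipliers D) ⟩
      weighted (λ r → sumFin m (λ u → onCapacity u r * coef G u v e)) (multipliers D) + β v
        ≡⟨ cong (_+ β v) (weighted-sumL (allFin m) (λ u r → onCapacity u r * coef G u v e) (multipliers D)) ⟩
      sumFin m (λ u → weighted (λ r → onCapacity u r * coef G u v e) (multipliers D)) + β v
        ≡⟨ cong (_+ β v) (sumL-cong (allFin m) (λ u → weighted-*ʳ (onCapacity u) (coef G u v e) (multipliers D))) ⟩
      sumFin m (λ u → α u * coef G u v e) + β v ∎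
      where open ≤-Reasoning

    α-nonNeg : (u : Fin m) → 0ℚ ≤ α u
    α-nonNeg u = weighted-nonNeg (multipliers D) 0≤multiplier (onCapacity-nonNeg u)

    vertex-bound : (y : QCSol G) → QCFeasible G y → (v : Fin n) →
      sumFin m (λ u → (w u v - α u) * (p u v * y u v)) ≤ β v
    vertex-bound y (y≥0 , qc , _) v = begin
      sumFin m (λ u → d u * z u)
        ≤⟨ sumFin≤sumSub-positiveSet d z (λ u → *-nonNeg (p-nonneg u v) (y≥0 u v)) ⟩
      sumSub (positiveSet d) (λ u → d u * z u)
        ≤⟨ dominates ⟩
      valueWith G d v 1ℚ order
        ≡⟨ valueWith≡Σcoef G d v 1ℚ unique ⟩
      sumFin m (λ u → d u * coef G u v order)
        ≡⟨ sumL-cong (allFin m) (λ u → *-distribʳ-+ (coef G u v order) (w u v) (- α u)) ⟩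
      sumFin m (λ u → w u v * coef G u v order + - α u * coef G u v order)
        ≡⟨ sumL-cong (allFin m) (λ u → cong (w u v * coef G u v order +_) (sym (neg-distribˡ-* (α u) _))) ⟩
      sumFin m (λ u → w u v * coef G u v order - α u * coef G u v order)
        ≡⟨ sumL-sub (allFin m) (λ u → w u v * coef G u v order) (λ u → α u * coef G u v order) ⟩
      sumFin m (λ u → w u v * coef G u v order) - Σα
        ≡⟨ cong (_- Σα) (val≡Σcoef G v order∈) ⟨
      val G v order - Σα
        ≤⟨ +-monoˡ-≤ (- Σα) (dual-feasible v order∈) ⟩
      Σα + β v - Σα
        ≡⟨ cancel Σα (β v) ⟩
      β v ∎
      where
      open ≤-Reasoning
      d z : Fin m → ℚ
      d u = w u v - α u
      z u = p u v * y u v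
      open Greedy G v z (qc v) using (module Order; greedy)
      open Order (greedy m (positiveSet d) (∣p∣≤n (positiveSet d)) d (λ u∈ → <⇒≤ (∈-positiveSet d u∈)))
      order∈ = ∈-distinctUpTo⁺ m unique short
      Σα = sumFin m (λ u → α u * coef G u v order)
      cancel : ∀ a b → a + b - a ≡ b
      cancel = solve-∀ ℚ-ring

    qcObj-split : (y : QCSol G) → qcObj G y ≡
      sumFin n (λ v → sumFin m (λ u → (w u v - α u) * (p u v * y u v))) + sumFin m (λ u → α u * sumFin n (λ v → p u v * y u v))
    qcObj-split y = begin
      sumFin m (λ u → sumFin n (λ v → w u v * p u v * y u v))
        ≡⟨ sumL-cong (allFin m) (λ u → sumL-cong (allFin n) (λ v → split (w u v) (α u) (p u v) (y u v))) ⟩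
      sumFin m (λ u → sumFin n (λ v → (w u v - α u) * z u v + α u * z u v))
        ≡⟨ sumL-cong (allFin m) (λ u → sumL-+ (allFin n) (λ v → (w u v - α u) * z u v) (λ v → α u * z u v)) ⟩
      sumFin m (λ u → sumFin n (λ v → (w u v - α u) * z u v) + sumFin n (λ v → α u * z u v))
        ≡⟨ sumL-+ (allFin m) (λ u → sumFin n (λ v → (w u v - α u) * z u v)) (λ u → sumFin n (λ v → α u * z u v)) ⟩
      sumFin m (λ u → sumFin n (λ v → (w u v - α u) * z u v)) + sumFin m (λ u → sumFin n (λ v → α u * z u v))
        ≡⟨ cong₂ _+_ (sumL-swap (allFin m) (allFin n) (λ u v → (w u v - α u) * z u v))
                     (sumL-cong (allFin m) (λ u → sumL-*ˡ (allFin n) (α u) (z u))) ⟩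
      sumFin n (λ v → sumFin m (λ u → (w u v - α u) * z u v)) + sumFin m (λ u → α u * sumFin n (z u)) ∎
      where
      open ≡-Reasoning
      z : Fin m → Fin n → ℚ
      z u v = p u v * y u v
      split : ∀ w a p y → w * p * y ≡ (w - a) * (p * y) + a * (p * y)
      split = solve-∀ ℚ-ring

    qc-bound : (y : QCSol G) → QCFeasible G y → qcObj G y ≤ value D
    qc-bound y feasible@(_ , _ , y-capacity) = begin
      qcObj G y
        ≡⟨ qcObj-split y ⟩
      sumFin n (λ v → sumFin m (λ u → (w u v - α u) * (p u v * y u v))) + sumFin m (λ u → α u * sumFin n (λ v → p u v * y u v))
        ≤⟨ +-mono-≤ (sumL-mono (allFin n) (vertex-bound y feasible))
                    (sumL-mono (allFin m) (λ u → *-monoˡ-≤-0≤ (α-nonNeg u) (y-capacity u))) ⟩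
      sumFin n β + sumFin m (λ u → α u * 1ℚ)
        ≡⟨ cong (sumFin n β +_) (sumL-cong (allFin m) (λ u → *-identityʳ (α u))) ⟩
      sumFin n β + sumFin m α
        ≡⟨ +-comm (sumFin n β) (sumFin m α) ⟩
      sumFin m α + sumFin n β
        ≡⟨ value-split ⟨
      value D ∎
      where open ≤-Reasoning

  x* : ConfigSol G
  x* = curry′ (proj₁ optimum)

  x*-feasible : ConfigFeasible G x*
  x*-feasible = feasible⇒configFeasible (proj₁ (proj₂ optimum))

  D* : DualCertificate
  D* = proj₁ (proj₂ (proj₂ optimum))

  value≤x* : value D* ≤ configObj G x*
  value≤x* = subst (value D* ≤_) (sym (configObj≡objective x*)) (proj₂ (proj₂ (proj₂ optimum)))

  x*-optimal : ∀ x → ConfigFeasible G x → configObj G x ≤ configObj G x*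
  x*-optimal x feasible = begin
    configObj G x             ≡⟨ configObj≡objective x ⟩
    objective (uncurry′ x)    ≤⟨ weak-duality D* (configFeasible⇒feasible feasible) ⟩
    value D*        ≤⟨ value≤x* ⟩
    configObj G x*       ∎
    where open ≤-Reasoning

  marginals-optimal : ∀ y → QCFeasible G y → qcObj G y ≤ qcObj G (marginals G x*)
  marginals-optimal y feasible = begin
    qcObj G y                       ≤⟨ Dual.qc-bound D* y feasible ⟩
    value D*              ≤⟨ value≤x* ⟩
    configObj G x*             ≡⟨ marginals-objective G x* ⟨
    qcObj G (marginals G x*)   ∎
    where open ≤-Reasoning

proposition27 : (m n : ℕ) (G : StochGraph m n) →
    Σ ℚ (λ r → IsLPOPT G r × IsLPOPT-QC G r)
proposition27 m n G =
  configObj G x*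
    , (x* , (x*-feasible , x*-optimal) , refl)
    , (marginals G x* , (marginals-feasible G x* x*-feasible , marginals-optimal) , marginals-objective G x*)
  where open ConfigLP G
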